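{- Let $n$ be a negative integer and let $p$ be an even positive integer with $p\ge 1+\sqrt{1-8n}$. Put $\tau=n-\frac p4\left(1-\frac p2\right)$ (a non-negative integer). Let $\mu=\frac{p^2}{4}+2p+2$, $\gamma=2\mu-\left(\frac p2+4\right)$, $m=\mu+\tau\frac p2$, $g=\gamma+\tau(p-1)$, $c=p\mu+\tau\left(\frac{p^2}{2}-1\right)$, and $S(p,\tau)=\langle m,g,g+1\rangle_c$. Then $\mathrm{E}(S(p,\tau))=n$.
   Context: A numerical semigroup is a submonoid of $(\mathbb N,+)$ with finite complement. For integers $a_1,\dots,a_r$ and $t$, $\langle a_1,\dots,a_r\rangle_t$ denotes the smallest numerical semigroup containing $a_1,\dots,a_r$ and all integers $\ge t$. For a numerical semigroup $S$: conductor $c(S)$ is the smallest integer such that all integers $\ge c(S)$ are in $S$; multiplicity $m(S)$ is its least positive element; $L=\{s\in S: s<c(S)\}$; $P$ is the set of minimal generators; $q=\lceil c(S)/m(S)\rceil$; $\rho=q\,m(S)-c(S)$; $I_q=\{z\in\mathbb Z: c(S)\le z<c(S)+m(S)\}$; $D_q=I_q\setminus P$. The Eliahou number is $\mathrm{E}(S)=|P\cap L|\,|L|-q\,|D_q|+\rho$. -}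

module Defs where

open import Data.Nat using (ℕ; zero; suc; _+_; _*_; _∸_; _≤_; _<_; _≡ᵇ_; _≤ᵇ_; _<ᵇ_)
open import Data.Nat.DivMod using (_/_)
open import Data.Bool using (Bool; true; false; _∧_; _∨_; not)
open import Data.List using (List; []; _∷_; upTo; filter; length; map)
open import Data.Bool.ListAction using (any)
open import Data.Integer as ℤ using (ℤ; +_)
open import Relation.Binary.PropositionalEquality using (_≡_)
open import Relation.Nullary.Decidable using (does)
open import Data.Bool.Properties using (T?)
open import Data.Bool using (T)

Subsetℕ : Set
Subsetℕ = ℕ → Bool

-- x is a ℕ-linear combination  Σ kᵢ aᵢ  of the entries of the list
-- (each coefficient kᵢ ranges over 0..x, which loses nothing).
rep : List ℕ → ℕ → Bool
rep []       x = x ≡ᵇ 0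
rep (a ∷ as) x = any (λ j → (j * a ≤ᵇ x) ∧ rep as (x ∸ j * a)) (upTo (suc x))

-- ⟨ a₁ , … , a_r ⟩_t : the smallest numerical semigroup containing the aᵢ
-- and all integers ≥ t, namely {ℕ-combinations of the aᵢ} ∪ [t, ∞).
⟨_⟩_ : List ℕ → ℕ → Subsetℕ
(⟨ gs ⟩ t) x = (t ≤ᵇ x) ∨ rep gs x

IsConductor : Subsetℕ → ℕ → Set
IsConductor S c =
  ((z : ℕ) → c ≤ z → S z ≡ true) ×' ((c' : ℕ) → ((z : ℕ) → c' ≤ z → S z ≡ true) → c ≤ c')
  where
  open import Data.Product using () renaming (_×_ to _×'_)

IsMultiplicity : Subsetℕ → ℕ → Set
IsMultiplicity S m =
  (0 < m) ×' ((S m ≡ true) ×' ((k : ℕ) → 0 < k → k < m → S k ≡ false))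
  where
  open import Data.Product using () renaming (_×_ to _×'_)

isMinGen : Subsetℕ → ℕ → Bool
isMinGen S s =
  S s ∧ not (s ≡ᵇ 0)
      ∧ not (any (λ a → (0 <ᵇ a) ∧ S a ∧ S (s ∸ a)) (upTo s))

-- ⌈ c / m ⌉ (m > 0 in all uses)
ceilDiv : ℕ → ℕ → ℕ
ceilDiv c zero    = 0
ceilDiv c (suc k) = (c + k) / suc k

count : (ℕ → Bool) → List ℕ → ℕ
count f xs = length (filter (λ x → T? (f x)) xs)

-- Eliahou number of S, given its conductor c and multiplicity m:
--   L   = { s ∈ S : s < c },  P = minimal generators,
--   q   = ⌈c/m⌉, ρ = q m − c, I_q = [c, c+m), D_q = I_q \ P,
--   E   = |P ∩ L| |L| − q |D_q| + ρ.
eliahou : Subsetℕ → (c m : ℕ) → ℤ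
eliahou S c m =
  ((+ nPL) ℤ.* (+ nL) ℤ.- (+ q) ℤ.* (+ nD)) ℤ.+ ((+ (q * m)) ℤ.- (+ c))
  where
  L  = filter (λ s → T? (S s)) (upTo c)
  nL  = length L
  nPL = count (isMinGen S) L
  q   = ceilDiv c m
  Iq  = map (λ i → c + i) (upTo m)
  nD  = count (λ z → not (isMinGen S z)) Iq

-- The parameters of the corollary (p even, so all divisions are exact).
τ′ : ℤ → ℕ → ℤ
τ′ n p = n ℤ.+ (+ (p * (p ∸ 2) / 8))   -- = n − (p/4)(1 − p/2)

μ′ : ℕ → ℕ
μ′ p = p * p / 4 + 2 * p + 2

γ′ : ℕ → ℕ
γ′ p = 2 * μ′ p ∸ (p / 2 + 4)

-- τ is a non-negative integer; we use its absolute value as a natural number.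
mult′ : ℤ → ℕ → ℕ
mult′ n p = μ′ p + ℤ.∣ τ′ n p ∣ * (p / 2)

gen′ : ℤ → ℕ → ℕ
gen′ n p = γ′ p + ℤ.∣ τ′ n p ∣ * (p ∸ 1)

cond′ : ℤ → ℕ → ℕ
cond′ n p = p * μ′ p + ℤ.∣ τ′ n p ∣ * (p * p / 2 ∸ 1)

Spτ : ℤ → ℕ → Subsetℕ
Spτ n p = ⟨ mult′ n p ∷ gen′ n p ∷ suc (gen′ n p) ∷ [] ⟩ cond′ n p

-- Write p = 2k and δ = k + 4 + τ, so that m = kδ + 2 and g + δ = 2m. If x = a m + b g + l (g + 1)
-- and B = b + l, then x + Bδ = (a + 2B) m + l. Cutting ℕ into blocks [N m + 1, (N + 1) m], this
-- identity determines exactly which positions of block N are reached: for N < 2k they are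
-- triangle (⌊(N + 1)/2⌋ + 1) many, and block 2k also contains the k + 2 numbers (k + 1) g + j.
-- Hence |L| = 1² + ⋯ + (k + 1)² − 1 and |D_q| = triangle (k + 1) + k + 2, while the minimal
-- generators below c are m, g, g + 1, q = 2k and ρ = τ. The Eliahou number is then n by a
-- polynomial identity in k, since τ = n + triangle (k − 1).

module Submission where

open import Defs
open import Data.Bool using (Bool; true; false; _∧_; _∨_; not; T)
open import Data.Bool.Properties using (T?; ∧-distribˡ-∨; not-involutive)
open import Data.Bool.ListAction using (any)
open import Data.Empty using (⊥-elim)
open import Data.Integer as ℤ using (ℤ; -[1+_]; _⊖_)
import Data.Integer.Properties as ℤ
import Data.Integer.Tactic.RingSolver as ℤ-Solver
open import Data.List using (List; []; _∷_; upTo; applyUpTo; filter; length; map)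
open import Data.List.Properties using (map-upTo)
open import Data.List.Relation.Unary.Any.Properties using (any⁺; any⁻; applyUpTo⁺; applyUpTo⁻)
open import Data.Nat
open import Data.Nat.DivMod using (_/_; +-distrib-/-∣ˡ; m*n/n≡m; m<n⇒m/n≡0)
open import Data.Nat.Divisibility using (_∣_; divides; divides-refl)
open import Data.Nat.Properties
open import Data.Nat.Tactic.RingSolver using (solve-∀)
open import Data.Product using (Σ; ∃; _×_; _,_; proj₁; proj₂)
open import Data.Sum using (_⊎_; inj₁; inj₂)
open import Data.Unit using (tt)
open import Function using (id; _∘_)
open import Relation.Binary.Definitions using (tri<; tri≈; tri>)
open import Relation.Binary.PropositionalEquality
open import Relation.Nullary using (¬_; Dec; yes; no)

T-ext : ∀ {a b : Bool} → (T a → T b) → (T b → T a) → a ≡ b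
T-ext {false} {false} _ _ = refl
T-ext {false} {true}  _ g = ⊥-elim (g tt)
T-ext {true}  {false} f _ = ⊥-elim (f tt)
T-ext {true}  {true}  _ _ = refl

T⇒≡true : ∀ {a} → T a → a ≡ true
T⇒≡true {true} _ = refl

¬T⇒≡false : ∀ {a} → ¬ T a → a ≡ false
¬T⇒≡false {false} _ = refl
¬T⇒≡false {true}  h = ⊥-elim (h tt)

¬T⇒T-not : ∀ {a} → ¬ T a → T (not a)
¬T⇒T-not {false} _ = tt
¬T⇒T-not {true}  h = h tt

T-not⇒¬T : ∀ {a} → T (not a) → ¬ T a
T-not⇒¬T {false} _ ()

∧-elim : ∀ {a b} → T (a ∧ b) → T a × T b
∧-elim {true} {true} _ = tt , tt

∧-intro : ∀ {a b} → T a → T b → T (a ∧ b)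
∧-intro {true} {true} _ _ = tt

∨-elim : ∀ {a b} → T (a ∨ b) → T a ⊎ T b
∨-elim {true}          _ = inj₁ tt
∨-elim {false} {true}  _ = inj₂ tt

∨-introˡ : ∀ {a b} → T a → T (a ∨ b)
∨-introˡ {true} _ = tt

∨-introʳ : ∀ {a b} → T b → T (a ∨ b)
∨-introʳ {true}         _ = tt
∨-introʳ {false} {true} _ = tt

any-upTo⁻ : ∀ (f : ℕ → Bool) n → T (any f (upTo n)) → ∃ λ i → i < n × T (f i)
any-upTo⁻ f n p = applyUpTo⁻ id (any⁻ f (upTo n) p)

any-upTo⁺ : ∀ (f : ℕ → Bool) {i n} → i < n → T (f i) → T (any f (upTo n))
any-upTo⁺ f i<n p = any⁺ f (applyUpTo⁺ id p i<n)

indicator : Bool → ℕ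
indicator true  = 1
indicator false = 0

tally : (ℕ → Bool) → ℕ → ℕ
tally f zero    = 0
tally f (suc n) = indicator (f 0) + tally (f ∘ suc) n

count-applyUpTo : ∀ f h n → count f (applyUpTo h n) ≡ tally (f ∘ h) n
count-applyUpTo f h zero = refl
count-applyUpTo f h (suc n) with f (h 0)
... | true  = cong suc (count-applyUpTo f (h ∘ suc) n)
... | false = count-applyUpTo f (h ∘ suc) n

count-filter : ∀ (f h : ℕ → Bool) xs →
               count f (filter (T? ∘ h) xs) ≡ count (λ x → h x ∧ f x) xs
count-filter f h [] = refl
count-filter f h (x ∷ xs) with h x
... | false = count-filter f h xs
... | true with f x
...   | true  = cong suc (count-filter f h xs)
...   | false = count-filter f h xs

tally-cong : ∀ {f f'} n → (∀ i → i < n → f i ≡ f' i) → tally f n ≡ tally f' n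
tally-cong zero    _ = refl
tally-cong (suc n) e = cong₂ _+_ (cong indicator (e 0 z<s)) (tally-cong n (λ i i<n → e (suc i) (s<s i<n)))

tally-+ : ∀ f a b → tally f (a + b) ≡ tally f a + tally (λ i → f (a + i)) b
tally-+ f zero    b = refl
tally-+ f (suc a) b = trans (cong (indicator (f 0) +_) (tally-+ (f ∘ suc) a b))
                            (sym (+-assoc (indicator (f 0)) _ _))

tally-none : ∀ {f} n → (∀ i → i < n → f i ≡ false) → tally f n ≡ 0
tally-none zero    _ = refl
tally-none (suc n) e rewrite e 0 z<s = tally-none n (λ i i<n → e (suc i) (s<s i<n))

tally-all : ∀ {f} n → (∀ i → i < n → f i ≡ true) → tally f n ≡ n
tally-all zero    _ = refl
tally-all (suc n) e rewrite e 0 z<s = cong suc (tally-all n (λ i i<n → e (suc i) (s<s i<n)))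

tally-last : ∀ f n → (∀ i → i < n → f i ≡ false) → f n ≡ true → tally f (n + 1) ≡ 1
tally-last f n none last = begin
  tally f (n + 1)                             ≡⟨ tally-+ f n 1 ⟩
  tally f n + (indicator (f (n + 0)) + 0)     ≡⟨ cong₂ (λ u b → u + (indicator b + 0)) (tally-none n none)
                                                       (trans (cong f (+-identityʳ n)) last) ⟩
  1                                           ∎
  where open ≡-Reasoning

indicator-∨ : ∀ a b → a ∧ b ≡ false → indicator (a ∨ b) ≡ indicator a + indicator b
indicator-∨ true  false _ = refl
indicator-∨ false b     _ = refl

tally-∨ : ∀ f g n → (∀ i → i < n → f i ∧ g i ≡ false) →
          tally (λ i → f i ∨ g i) n ≡ tally f n + tally g n
tally-∨ f g zero    _ = refl
tally-∨ f g (suc n) e =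
  trans (cong₂ _+_ (indicator-∨ (f 0) (g 0) (e 0 z<s))
                   (tally-∨ (f ∘ suc) (g ∘ suc) n (λ i i<n → e (suc i) (s<s i<n))))
        (+-assoc-swap (indicator (f 0)) (indicator (g 0)) _ _)
  where
  +-assoc-swap : ∀ a b c d → (a + b) + (c + d) ≡ (a + c) + (b + d)
  +-assoc-swap = solve-∀

tally-interval : ∀ f lo w r → (∀ i → i < lo → f i ≡ false) → (∀ i → i ≤ w → f (lo + i) ≡ true) →
                 (∀ i → i < r → f (lo + suc w + i) ≡ false) → tally f (lo + suc w + r) ≡ suc w
tally-interval f lo w r below inside above = begin
  tally f (lo + suc w + r)
    ≡⟨ tally-+ f (lo + suc w) r ⟩
  tally f (lo + suc w) + tally (λ i → f (lo + suc w + i)) r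
    ≡⟨ cong₂ _+_ (tally-+ f lo (suc w)) (tally-none r above) ⟩
  tally f lo + tally (λ i → f (lo + i)) (suc w) + 0
    ≡⟨ cong₂ (λ u v → u + v + 0) (tally-none lo below) (tally-all (suc w) (λ i i≤w → inside i (≤-pred i≤w))) ⟩
  suc w + 0
    ≡⟨ +-identityʳ _ ⟩
  suc w ∎
  where open ≡-Reasoning

tally-≡ᵇ : ∀ x n → x < n → tally (_≡ᵇ x) n ≡ 1
tally-≡ᵇ x n x<n with r , refl ← m≤n⇒∃[o]m+o≡n x<n =
  subst (λ u → tally (_≡ᵇ x) (u + r) ≡ 1) (+-comm x 1) (tally-interval (_≡ᵇ x) x 0 r below inside above)
  where
  below : ∀ i → i < x → (i ≡ᵇ x) ≡ false
  below i i<x = ¬T⇒≡false (λ i≡x → <-irrefl (≡ᵇ⇒≡ i x i≡x) i<x)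
  inside : ∀ i → i ≤ 0 → (x + i ≡ᵇ x) ≡ true
  inside .0 z≤n = T⇒≡true (≡⇒≡ᵇ (x + 0) x (+-identityʳ x))
  above : ∀ i → i < r → (x + 1 + i ≡ᵇ x) ≡ false
  above i _ = ¬T⇒≡false (λ eq → <-irrefl (sym (≡ᵇ⇒≡ _ x eq)) (≤-trans (≤-reflexive (+-comm 1 x)) (m≤m+n (x + 1) i)))

≡ᵇ-disjoint : ∀ {x y} → x ≢ y → ∀ i → (i ≡ᵇ x) ∧ (i ≡ᵇ y) ≡ false
≡ᵇ-disjoint {x} {y} x≢y i = ¬T⇒≡false λ p →
  let i≡x , i≡y = ∧-elim {i ≡ᵇ x} p in x≢y (trans (sym (≡ᵇ⇒≡ i x i≡x)) (≡ᵇ⇒≡ i y i≡y))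

tally-three-points : ∀ {x y z n} → x < y → y < z → z < n →
                     tally (λ i → (i ≡ᵇ x) ∨ ((i ≡ᵇ y) ∨ (i ≡ᵇ z))) n ≡ 3
tally-three-points {x} {y} {z} {n} x<y y<z z<n = begin
  tally (λ i → (i ≡ᵇ x) ∨ ((i ≡ᵇ y) ∨ (i ≡ᵇ z))) n
    ≡⟨ tally-∨ (_≡ᵇ x) _ n (λ i _ → trans (∧-distribˡ-∨ (i ≡ᵇ x) (i ≡ᵇ y) (i ≡ᵇ z))
                                          (cong₂ _∨_ (≡ᵇ-disjoint (<⇒≢ x<y) i) (≡ᵇ-disjoint (<⇒≢ x<z) i))) ⟩
  tally (_≡ᵇ x) n + tally (λ i → (i ≡ᵇ y) ∨ (i ≡ᵇ z)) n
    ≡⟨ cong (tally (_≡ᵇ x) n +_) (tally-∨ (_≡ᵇ y) (_≡ᵇ z) n (λ i _ → ≡ᵇ-disjoint (<⇒≢ y<z) i)) ⟩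
  tally (_≡ᵇ x) n + (tally (_≡ᵇ y) n + tally (_≡ᵇ z) n)
    ≡⟨ cong₂ _+_ (tally-≡ᵇ x n (<-trans x<z z<n)) (cong₂ _+_ (tally-≡ᵇ y n (<-trans y<z z<n)) (tally-≡ᵇ z n z<n)) ⟩
  3 ∎
  where
  open ≡-Reasoning
  x<z = <-trans x<y y<z

inRange : ℕ → ℕ → ℕ → Bool
inRange lo w v = (lo ≤ᵇ v) ∧ (v ≤ᵇ lo + w)

inRange⁻ : ∀ lo w v → T (inRange lo w v) → Σ ℕ λ j → j ≤ w × v ≡ lo + j
inRange⁻ lo w v p with lo≤v , v≤ ← ∧-elim {lo ≤ᵇ v} p =
  v ∸ lo , +-cancelˡ-≤ lo _ _ (subst (_≤ lo + w) v≡ (≤ᵇ⇒≤ _ _ v≤)) , v≡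
  where
  v≡ : v ≡ lo + (v ∸ lo)
  v≡ = sym (m+[n∸m]≡n (≤ᵇ⇒≤ lo v lo≤v))

inRange⁺ : ∀ lo w j → j ≤ w → T (inRange lo w (lo + j))
inRange⁺ lo w j j≤w = ∧-intro {lo ≤ᵇ lo + j} (≤⇒≤ᵇ (m≤m+n lo j)) (≤⇒≤ᵇ (+-monoʳ-≤ lo j≤w))

tally-inRange : ∀ M w D lo r → lo + 1 + D ≡ M →
                tally (λ i → inRange M w (i + 1 + D)) (lo + suc w + r) ≡ suc w
tally-inRange M w D lo r lo+1+D≡M = tally-interval _ lo w r below inside above
  where
  open ≤-Reasoning
  below : ∀ i → i < lo → inRange M w (i + 1 + D) ≡ false
  below i i<lo = ¬T⇒≡false (λ p → <-irrefl refl (begin-strict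
    M          ≤⟨ ≤ᵇ⇒≤ M _ (proj₁ (∧-elim {M ≤ᵇ i + 1 + D} p)) ⟩
    i + 1 + D  <⟨ +-monoˡ-< D (+-monoˡ-< 1 i<lo) ⟩
    lo + 1 + D ≡⟨ lo+1+D≡M ⟩
    M          ∎))
  shift : ∀ i → lo + i + 1 + D ≡ M + i
  shift i = trans (rearrange lo i D) (cong (_+ i) lo+1+D≡M)
    where
    rearrange : ∀ a b c → a + b + 1 + c ≡ a + 1 + c + b
    rearrange = solve-∀
  inside : ∀ i → i ≤ w → inRange M w (lo + i + 1 + D) ≡ true
  inside i i≤w rewrite shift i = T⇒≡true (inRange⁺ M w i i≤w)
  above : ∀ i → i < r → inRange M w (lo + suc w + i + 1 + D) ≡ false
  above i _ = ¬T⇒≡false (λ p → <-irrefl refl (begin-strict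
    M + w                      <⟨ +-monoʳ-< M (s≤s (m≤m+n w i)) ⟩
    M + (suc w + i)            ≡⟨ shift (suc w + i) ⟨
    lo + (suc w + i) + 1 + D   ≡⟨ cong (λ u → u + 1 + D) (+-assoc lo (suc w) i) ⟨
    lo + suc w + i + 1 + D     ≤⟨ ≤ᵇ⇒≤ _ _ (proj₂ (∧-elim {M ≤ᵇ lo + suc w + i + 1 + D} p)) ⟩
    M + w                      ∎))

-- Representations by three generators

Rep₃ : ℕ → ℕ → ℕ → ℕ → Set
Rep₃ m g h x = Σ ℕ λ a → Σ ℕ λ b → Σ ℕ λ l → a * m + b * g + l * h ≡ x

rep-∷⁻ : ∀ a as x → T (rep (a ∷ as) x) → Σ ℕ λ j → j * a ≤ x × T (rep as (x ∸ j * a))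
rep-∷⁻ a as x p with j , _ , q ← any-upTo⁻ _ (suc x) p with q₁ , q₂ ← ∧-elim {j * a ≤ᵇ x} q =
  j , ≤ᵇ⇒≤ _ _ q₁ , q₂

rep-∷⁺ : ∀ a as x j → j * a ≤ x → T (rep as (x ∸ j * a)) → T (rep (a ∷ as) x)
rep-∷⁺ zero as x j _ q =
  any-upTo⁺ _ (s≤s (z≤n {x})) (∧-intro {0 ≤ᵇ x} (≤⇒≤ᵇ (z≤n {x})) (subst (λ u → T (rep as (x ∸ u))) (*-zeroʳ j) q))
rep-∷⁺ (suc a) as x j le q =
  any-upTo⁺ _ (s≤s (≤-trans (m≤m*n j (suc a)) le)) (∧-intro (≤⇒≤ᵇ le) q)

rep₃⁻ : ∀ m g h x → T (rep (m ∷ g ∷ h ∷ []) x) → Rep₃ m g h x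
rep₃⁻ m g h x p
  with a , am≤x , p₁ ← rep-∷⁻ m (g ∷ h ∷ []) x p
  with b , bg≤ , p₂ ← rep-∷⁻ g (h ∷ []) _ p₁
  with l , lh≤ , p₃ ← rep-∷⁻ h [] _ p₂ = a , b , l , (begin
    a * m + b * g + l * h     ≡⟨ +-assoc (a * m) _ _ ⟩
    a * m + (b * g + l * h)
      ≡⟨ cong (λ u → a * m + (b * g + (u + l * h))) (sym (≡ᵇ⇒≡ _ 0 p₃)) ⟩
    a * m + (b * g + (x ∸ a * m ∸ b * g ∸ l * h + l * h))
      ≡⟨ cong (λ u → a * m + (b * g + u)) (m∸n+n≡m lh≤) ⟩
    a * m + (b * g + (x ∸ a * m ∸ b * g))  ≡⟨ cong (a * m +_) (m+[n∸m]≡n bg≤) ⟩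
    a * m + (x ∸ a * m)       ≡⟨ m+[n∸m]≡n am≤x ⟩
    x ∎)
  where open ≡-Reasoning

rep₃⁺ : ∀ m g h x → Rep₃ m g h x → T (rep (m ∷ g ∷ h ∷ []) x)
rep₃⁺ m g h .(a * m + b * g + l * h) (a , b , l , refl) =
  rep-∷⁺ m (g ∷ h ∷ []) _ a (subst (a * m ≤_) (sym assoc) (m≤m+n _ _))
    (subst (λ u → T (rep (g ∷ h ∷ []) u)) (sym rest)
      (rep-∷⁺ g (h ∷ []) _ b (m≤m+n _ _)
        (subst (λ u → T (rep (h ∷ []) u)) (sym (m+n∸m≡n (b * g) (l * h)))
          (rep-∷⁺ h [] _ l ≤-refl (subst (λ u → T (rep [] u)) (sym (n∸n≡0 (l * h))) tt)))))
  where
  assoc : a * m + b * g + l * h ≡ a * m + (b * g + l * h)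
  assoc = +-assoc (a * m) _ _
  rest : a * m + b * g + l * h ∸ a * m ≡ b * g + l * h
  rest = trans (cong (_∸ a * m) assoc) (m+n∸m≡n (a * m) _)

Rep₃-+ : ∀ {m g h x y} → Rep₃ m g h x → Rep₃ m g h y → Rep₃ m g h (x + y)
Rep₃-+ {m} {g} {h} (a , b , l , refl) (a' , b' , l' , refl) =
  a + a' , b + b' , l + l' , distrib a b l a' b' l' m g h
  where
  distrib : ∀ a b l a' b' l' m g h →
            (a + a') * m + (b + b') * g + (l + l') * h ≡ (a * m + b * g + l * h) + (a' * m + b' * g + l' * h)
  distrib = solve-∀

triangle : ℕ → ℕ
triangle zero    = 0
triangle (suc n) = triangle n + suc n

triangle-closed : ∀ n → triangle n * 2 ≡ suc n * n
triangle-closed zero    = refl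
triangle-closed (suc n) = begin
  (triangle n + suc n) * 2       ≡⟨ *-distribʳ-+ 2 (triangle n) (suc n) ⟩
  triangle n * 2 + suc n * 2     ≡⟨ cong (_+ suc n * 2) (triangle-closed n) ⟩
  suc n * n + suc n * 2          ≡⟨ step n ⟩
  suc (suc n) * suc n ∎
  where
  open ≡-Reasoning
  step : ∀ n → suc n * n + suc n * 2 ≡ suc (suc n) * suc n
  step = solve-∀

squarePyramidal : ℕ → ℕ
squarePyramidal zero    = 0
squarePyramidal (suc n) = squarePyramidal n + suc n * suc n

squarePyramidal-closed : ∀ n → 6 * squarePyramidal n ≡ n * suc n * (2 * n + 1)
squarePyramidal-closed zero    = refl
squarePyramidal-closed (suc n) = begin
  6 * (squarePyramidal n + suc n * suc n)         ≡⟨ *-distribˡ-+ 6 (squarePyramidal n) _ ⟩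
  6 * squarePyramidal n + 6 * (suc n * suc n)     ≡⟨ cong (_+ 6 * (suc n * suc n)) (squarePyramidal-closed n) ⟩
  n * suc n * (2 * n + 1) + 6 * (suc n * suc n)   ≡⟨ step n ⟩
  suc n * suc (suc n) * (2 * suc n + 1) ∎
  where
  open ≡-Reasoning
  step : ∀ n → n * suc n * (2 * n + 1) + 6 * (suc n * suc n) ≡ suc n * suc (suc n) * (2 * suc n + 1)
  step = solve-∀

triangle-+-triangle-suc : ∀ n → triangle n + triangle (suc n) ≡ suc n * suc n
triangle-+-triangle-suc n = *-cancelʳ-≡ _ _ 2 (begin
  (triangle n + triangle (suc n)) * 2         ≡⟨ *-distribʳ-+ 2 (triangle n) _ ⟩
  triangle n * 2 + triangle (suc n) * 2       ≡⟨ cong₂ _+_ (triangle-closed n) (triangle-closed (suc n)) ⟩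
  suc n * n + suc (suc n) * suc n             ≡⟨ step n ⟩
  suc n * suc n * 2 ∎)
  where
  open ≡-Reasoning
  step : ∀ n → suc n * n + suc (suc n) * suc n ≡ suc n * suc n * 2
  step = solve-∀

-- S(p, τ) for p = 2k, k = k' + 1: with δ = k + 4 + τ, m = kδ + 2, g = (2k − 1)δ + 4 and
-- c = (2k − 1) m + 2 + e, where e = k + 4 + k'δ.
module Semigroup (k' τ m g c : ℕ)
  (m≡ : m ≡ suc k' * (suc k' + 4 + τ) + 2)
  (g≡ : g ≡ (suc k' + k') * (suc k' + 4 + τ) + 4)
  (c≡ : c ≡ (suc k' * (suc k' + k') + k') * (suc k' + 4 + τ) + (5 * suc k' + 4)) where

  open ≤-Reasoning

  k δ : ℕ
  k = suc k'
  δ = k + 4 + τ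

  g+δ≡m+m : g + δ ≡ m + m
  g+δ≡m+m rewrite m≡ | g≡ = identity k' δ
    where
    identity : ∀ k' D → (suc k' + k') * D + 4 + D ≡ suc k' * D + 2 + (suc k' * D + 2)
    identity = solve-∀

  c+τ≡[k+k]m : c + τ ≡ (k + k) * m
  c+τ≡[k+k]m rewrite m≡ | c≡ = identity k' τ
    where
    identity : ∀ k' τ → (suc k' * (suc k' + k') + k') * (suc k' + 4 + τ) + (5 * suc k' + 4) + τ
                      ≡ (suc k' + suc k') * (suc k' * (suc k' + 4 + τ) + 2)
    identity = solve-∀

  [k+1]g+δ≡[2k+1]m+2 : suc k * g + δ ≡ suc (k + k) * m + 2
  [k+1]g+δ≡[2k+1]m+2 rewrite m≡ | g≡ = identity k' δ
    where
    identity : ∀ k' D → suc (suc k') * ((suc k' + k') * D + 4) + D ≡ suc (suc k' + suc k') * (suc k' * D + 2) + 2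
    identity = solve-∀

  e : ℕ
  e = k + 4 + k' * δ

  τ+2+e≡m : τ + 2 + e ≡ m
  τ+2+e≡m rewrite m≡ = identity k' τ
    where
    identity : ∀ k' τ → τ + 2 + (suc k' + 4 + k' * (suc k' + 4 + τ)) ≡ suc k' * (suc k' + 4 + τ) + 2
    identity = solve-∀

  c≡[2k-1]m+2+e : c ≡ (k' + k) * m + 2 + e
  c≡[2k-1]m+2+e = +-cancelʳ-≡ τ _ _ (begin-equality
    c + τ                           ≡⟨ c+τ≡[k+k]m ⟩
    (k + k) * m                     ≡⟨ peel k' m ⟩
    (k' + k) * m + m                ≡⟨ cong ((k' + k) * m +_) τ+2+e≡m ⟨
    (k' + k) * m + (τ + 2 + e)      ≡⟨ rearrange ((k' + k) * m) τ e ⟩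
    (k' + k) * m + 2 + e + τ        ∎)
    where
    peel : ∀ k' m → (suc k' + suc k') * m ≡ (k' + suc k') * m + m
    peel = solve-∀
    rearrange : ∀ A τ e → A + (τ + 2 + e) ≡ A + 2 + e + τ
    rearrange = solve-∀

  Bδ+2≤m : ∀ {B} → B ≤ k → B * δ + 2 ≤ m
  Bδ+2≤m {B} B≤k = subst (B * δ + 2 ≤_) (sym m≡) (+-monoˡ-≤ 2 (*-monoˡ-≤ δ B≤k))

  k+4≤δ : k + 4 ≤ δ
  k+4≤δ = m≤m+n (k + 4) τ

  τ+3≤δ : τ + 3 ≤ δ
  τ+3≤δ = begin
    τ + 3        ≤⟨ +-monoʳ-≤ τ (≤-trans (n≤1+n 3) (m≤n+m 4 k)) ⟩
    τ + (k + 4)  ≡⟨ +-comm τ (k + 4) ⟩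
    δ            ∎

  k<δ : k < δ
  k<δ = begin-strict
    k      <⟨ m<m+n k (s≤s z≤n) ⟩
    k + 4  ≤⟨ k+4≤δ ⟩
    δ      ∎

  δ<m : δ < m
  δ<m = begin-strict
    δ          <⟨ m<m+n δ z<s ⟩
    δ + 2      ≡⟨ cong (_+ 2) (*-identityˡ δ) ⟨
    1 * δ + 2  ≤⟨ Bδ+2≤m (s≤s z≤n) ⟩
    m          ∎

  0<m : 0 < m
  0<m = ≤-trans (s≤s z≤n) δ<m

  m<g : m < g
  m<g = +-cancelʳ-< δ m g (begin-strict
    m + δ  <⟨ +-monoʳ-< m δ<m ⟩
    m + m  ≡⟨ g+δ≡m+m ⟨
    g + δ  ∎)

  δ<g : δ < g
  δ<g = <-trans δ<m m<g

  g+1<m+m : suc g < m + m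
  g+1<m+m = begin
    suc (suc g)  ≡⟨ +-comm 2 g ⟩
    g + 2  ≤⟨ +-monoʳ-≤ g (≤-trans (m≤n+m 2 2) (≤-trans (m≤n+m 4 k) k+4≤δ)) ⟩
    g + δ  ≡⟨ g+δ≡m+m ⟩
    m + m  ∎

  g+1<c : suc g < c
  g+1<c = +-cancelʳ-≤ τ (suc (suc g)) c (begin
    suc (suc g) + τ  ≡⟨ cong suc (+-suc g τ) ⟨
    suc g + suc τ    ≡⟨ +-suc g (suc τ) ⟨
    g + (2 + τ)      ≡⟨ cong (g +_) (+-comm 2 τ) ⟩
    g + (τ + 2)      ≤⟨ +-monoʳ-≤ g (≤-trans (+-monoʳ-≤ τ (n≤1+n 2)) τ+3≤δ) ⟩
    g + δ            ≡⟨ g+δ≡m+m ⟩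
    m + m            ≤⟨ +-monoʳ-≤ m (≤-trans (m≤m+n m (k' * m)) (*-monoˡ-≤ m (m≤n+m k k'))) ⟩
    (k + k) * m      ≡⟨ c+τ≡[k+k]m ⟨
    c + τ            ∎)

  m<c : m < c
  m<c = <-trans m<g (<-trans (n<1+n g) g+1<c)

  [k+k]m<[k+1]g : (k + k) * m < suc k * g
  [k+k]m<[k+1]g = +-cancelʳ-< δ _ _ (begin-strict
    (k + k) * m + δ      <⟨ +-monoʳ-< ((k + k) * m) (≤-trans δ<m (m≤m+n m 2)) ⟩
    (k + k) * m + (m + 2)  ≡⟨ identity ((k + k) * m) m ⟩
    suc (k + k) * m + 2    ≡⟨ [k+1]g+δ≡[2k+1]m+2 ⟨
    suc k * g + δ          ∎)
    where
    identity : ∀ x y → x + (y + 2) ≡ y + x + 2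
    identity = solve-∀

  [2k+1]m<[k+2]g : suc (k + k) * m < suc (suc k) * g
  [2k+1]m<[k+2]g = +-cancelʳ-< δ _ _ (begin-strict
    suc (k + k) * m + δ        <⟨ +-monoʳ-< (suc (k + k) * m) (≤-trans δ<g (m≤m+n g 2)) ⟩
    suc (k + k) * m + (g + 2)  ≡⟨ identity (suc (k + k) * m) g ⟩
    g + (suc (k + k) * m + 2)  ≡⟨ cong (g +_) [k+1]g+δ≡[2k+1]m+2 ⟨
    g + (suc k * g + δ)        ≡⟨ +-assoc g (suc k * g) δ ⟨
    suc (suc k) * g + δ        ∎)
    where
    identity : ∀ x y → x + (y + 2) ≡ y + (x + 2)
    identity = solve-∀

  [2k+1]m<m+[k+1]g : suc (k + k) * m < m + suc k * g
  [2k+1]m<m+[k+1]g = +-cancelʳ-< δ _ _ (begin-strict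
    suc (k + k) * m + δ        <⟨ +-monoʳ-< (suc (k + k) * m) (≤-trans δ<m (m≤m+n m 2)) ⟩
    suc (k + k) * m + (m + 2)  ≡⟨ identity (suc (k + k) * m) m ⟩
    m + (suc (k + k) * m + 2)  ≡⟨ cong (m +_) [k+1]g+δ≡[2k+1]m+2 ⟨
    m + (suc k * g + δ)        ≡⟨ +-assoc m (suc k * g) δ ⟨
    m + suc k * g + δ          ∎)
    where
    identity : ∀ x y → x + (y + 2) ≡ y + (x + 2)
    identity = solve-∀

  gens : List ℕ
  gens = m ∷ g ∷ suc g ∷ []

  R : ℕ → Set
  R = Rep₃ m g (suc g)

  -- x = a m + B g + j with j ≤ B: B summands from {g, g + 1}, j of them equal to g + 1.
  Rep : ℕ → Set
  Rep x = Σ ℕ λ a → Σ ℕ λ B → Σ ℕ λ j → j ≤ B × a * m + B * g + j ≡ x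

  R⇒Rep : ∀ {x} → R x → Rep x
  R⇒Rep (a , b , l , refl) = a , b + l , l , m≤n+m l b , regroup a b l m g
    where
    regroup : ∀ a b l m g → a * m + (b + l) * g + l ≡ a * m + b * g + l * suc g
    regroup = solve-∀

  Rep⇒R : ∀ {x} → Rep x → R x
  Rep⇒R (a , B , j , j≤B , refl) = a , B ∸ j , j , (begin-equality
    a * m + (B ∸ j) * g + j * suc g  ≡⟨ regroup a (B ∸ j) j m g ⟩
    a * m + (B ∸ j + j) * g + j      ≡⟨ cong (λ u → a * m + u * g + j) (m∸n+n≡m j≤B) ⟩
    a * m + B * g + j                ∎)
    where
    regroup : ∀ a b l m g → a * m + b * g + l * suc g ≡ a * m + (b + l) * g + l
    regroup = solve-∀

  rep⇒Rep : ∀ x → T (rep gens x) → Rep x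
  rep⇒Rep x = R⇒Rep ∘ rep₃⁻ m g (suc g) x

  Rep⇒rep : ∀ x → Rep x → T (rep gens x)
  Rep⇒rep x = rep₃⁺ m g (suc g) x ∘ Rep⇒R

  Rep-shift : ∀ a B j {x} → a * m + B * g + j ≡ x → x + B * δ ≡ (a + B + B) * m + j
  Rep-shift a B j refl = begin-equality
    a * m + B * g + j + B * δ  ≡⟨ regroup a B j m g δ ⟩
    a * m + B * (g + δ) + j    ≡⟨ cong (λ u → a * m + B * u + j) g+δ≡m+m ⟩
    a * m + B * (m + m) + j    ≡⟨ regroup′ a B j m ⟩
    (a + B + B) * m + j        ∎
    where
    regroup : ∀ a B j m g d → a * m + B * g + j + B * d ≡ a * m + B * (g + d) + j
    regroup = solve-∀
    regroup′ : ∀ a B j m → a * m + B * (m + m) + j ≡ (a + B + B) * m + j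
    regroup′ = solve-∀

  Rep-bound : ∀ a B j {x} → a * m + B * g + j ≡ x → B * g ≤ x
  Rep-bound a B j refl = ≤-trans (m≤n+m (B * g) (a * m)) (m≤m+n _ j)

  block-end : ∀ N {i} → i < m → N * m + 1 + i ≤ suc N * m
  block-end N {i} i<m = begin
    N * m + 1 + i  ≡⟨ +-assoc (N * m) 1 i ⟩
    N * m + suc i  ≤⟨ +-monoʳ-≤ (N * m) i<m ⟩
    N * m + m      ≡⟨ +-comm (N * m) m ⟩
    suc N * m      ∎

  shift-to-next-block : ∀ {N i B M j} → i < m → j ≤ B → B * δ + 2 ≤ m →
           N * m + 1 + i + B * δ ≡ M * m + j → M ≡ suc N × i + 1 + B * δ ≡ m + j
  shift-to-next-block {N} {i} {B} {M} {j} i<m j≤B Bδ+2≤m eq with <-cmp M (suc N)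
  ... | tri< M<N+1 _ _ = ⊥-elim (<-irrefl refl (begin-strict
    B * δ                 <⟨ s≤s (m≤n+m (B * δ) i) ⟩
    1 + i + B * δ         ≤⟨ +-cancelˡ-≤ (N * m) _ _ (begin
      N * m + (1 + i + B * δ)  ≡⟨ unshift ⟩
      M * m + j                ≤⟨ +-monoˡ-≤ j (*-monoˡ-≤ m (≤-pred M<N+1)) ⟩
      N * m + j                ∎) ⟩
    j                     ≤⟨ j≤B ⟩
    B                     ≤⟨ m≤m*n B δ ⟩
    B * δ                 ∎))
    where
    unshift : N * m + (1 + i + B * δ) ≡ M * m + j
    unshift = trans (reassoc (N * m) i (B * δ)) eq
      where
      reassoc : ∀ A i D → A + (1 + i + D) ≡ A + 1 + i + D
      reassoc = solve-∀
  ... | tri> _ _ M>N+1 = ⊥-elim (<-irrefl refl (begin-strict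
    m + m                  ≤⟨ +-cancelˡ-≤ (N * m) _ _ (begin
      N * m + (m + m)          ≡⟨ reassoc (N * m) m ⟩
      suc (suc N) * m          ≤⟨ *-monoˡ-≤ m M>N+1 ⟩
      M * m                    ≤⟨ m≤m+n (M * m) j ⟩
      M * m + j                ≡⟨ eq ⟨
      N * m + 1 + i + B * δ    ≡⟨ reassoc′ (N * m) i (B * δ) ⟩
      N * m + (1 + i + B * δ)  ∎) ⟩
    1 + i + B * δ          <⟨ m<m+n _ z<s ⟩
    1 + i + B * δ + 2      ≡⟨ +-assoc (1 + i) (B * δ) 2 ⟩
    1 + i + (B * δ + 2)    ≤⟨ +-mono-≤ i<m Bδ+2≤m ⟩
    m + m                  ∎))
    where
    reassoc : ∀ u v → u + (v + v) ≡ v + (v + u)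
    reassoc = solve-∀
    reassoc′ : ∀ A i D → A + 1 + i + D ≡ A + (1 + i + D)
    reassoc′ = solve-∀
  ... | tri≈ _ refl _ = refl , +-cancelˡ-≡ (N * m) _ _ (begin-equality
    N * m + (i + 1 + B * δ)  ≡⟨ reassoc (N * m) i (B * δ) ⟩
    N * m + 1 + i + B * δ    ≡⟨ eq ⟩
    suc N * m + j            ≡⟨ reassoc′ (N * m) m j ⟩
    N * m + (m + j)          ∎)
    where
    reassoc : ∀ A i D → A + (i + 1 + D) ≡ A + 1 + i + D
    reassoc = solve-∀
    reassoc′ : ∀ A m j → m + A + j ≡ A + (m + j)
    reassoc′ = solve-∀

  -- Position i of a block (the number N m + 1 + i, with i < m) is reached by a representation
  -- using B summands from {g, g + 1}, j of them g + 1, exactly when i + 1 + B δ = m + j.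
  reachedBy : ℕ → ℕ → Bool
  reachedBy B i = inRange m B (i + 1 + B * δ)

  reachedWithin : ℕ → ℕ → Bool
  reachedWithin zero    i = reachedBy 0 i
  reachedWithin (suc K) i = reachedWithin K i ∨ reachedBy (suc K) i

  -- In the block 2k the representations (k + 1) g + j, j ≤ k + 1, appear as well.
  reachedTop : ℕ → Bool
  reachedTop i = inRange (m + 2) (suc k) (i + 1 + δ)

  reachedWithin⁻ : ∀ K {i} → T (reachedWithin K i) → Σ ℕ λ B → B ≤ K × T (reachedBy B i)
  reachedWithin⁻ zero    p = 0 , z≤n , p
  reachedWithin⁻ (suc K) {i} p with ∨-elim {reachedWithin K i} p
  ... | inj₂ q = suc K , ≤-refl , q
  ... | inj₁ q with B , B≤K , r ← reachedWithin⁻ K q = B , m≤n⇒m≤1+n B≤K , r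

  reachedWithin⁺ : ∀ K {i B} → B ≤ K → T (reachedBy B i) → T (reachedWithin K i)
  reachedWithin⁺ zero    z≤n p = p
  reachedWithin⁺ (suc K) {i} B≤K+1 p with m≤n⇒m<n∨m≡n B≤K+1
  ... | inj₁ B<K+1 = ∨-introˡ {reachedWithin K i} (reachedWithin⁺ K (≤-pred B<K+1) p)
  ... | inj₂ refl  = ∨-introʳ {reachedWithin K i} p

  double≤odd⇒≤ : ∀ {B K} → B + B ≤ suc (K + K) → B ≤ K
  double≤odd⇒≤ {B} {K} B+B≤ with B ≤? K
  ... | yes B≤K = B≤K
  ... | no B≰K = ⊥-elim (<-irrefl refl (begin-strict
    suc (K + K)      <⟨ s≤s (≤-reflexive (sym (+-suc K K))) ⟩
    suc K + suc K    ≤⟨ +-mono-≤ (≰⇒> B≰K) (≰⇒> B≰K) ⟩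
    B + B            ≤⟨ B+B≤ ⟩
    suc (K + K)      ∎))

  Rep-summands≤k : ∀ {N i a B j} → suc N ≤ k + k → i < m →
                   a * m + B * g + j ≡ N * m + 1 + i → B ≤ k
  Rep-summands≤k {N} {i} {a} {B} {j} N+1≤2k i<m eq with B ≤? k
  ... | yes B≤k = B≤k
  ... | no B≰k = ⊥-elim (<-irrefl refl (begin-strict
    suc k * g        ≤⟨ *-monoˡ-≤ g (≰⇒> B≰k) ⟩
    B * g            ≤⟨ Rep-bound a B j eq ⟩
    N * m + 1 + i    ≤⟨ block-end N i<m ⟩
    suc N * m        ≤⟨ *-monoˡ-≤ m N+1≤2k ⟩
    (k + k) * m      <⟨ [k+k]m<[k+1]g ⟩
    suc k * g        ∎))

  few-summands⇒reachedWithin : ∀ {N K i a B j} → suc N ≤ suc (K + K) → i < m → B ≤ k → j ≤ B →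
                               a * m + B * g + j ≡ N * m + 1 + i → T (reachedWithin K i)
  few-summands⇒reachedWithin {N} {K} {i} {a} {B} {j} N+1≤ i<m B≤k j≤B eq
    with M≡N+1 , hit ← shift-to-next-block i<m j≤B (Bδ+2≤m B≤k)
                         (trans (cong (_+ B * δ) (sym eq)) (Rep-shift a B j refl))
    = reachedWithin⁺ K (double≤odd⇒≤ (≤-trans 2B≤N+1 N+1≤))
                       (subst (T ∘ inRange m B) (sym hit) (inRange⁺ m B j j≤B))
    where
    2B≤N+1 : B + B ≤ suc N
    2B≤N+1 = begin
      B + B          ≤⟨ m≤n+m (B + B) a ⟩
      a + (B + B)    ≡⟨ +-assoc a B B ⟨
      a + B + B      ≡⟨ M≡N+1 ⟩
      suc N          ∎

  reachedBy⇒Rep : ∀ {N i B} → B + B ≤ suc N → T (reachedBy B i) → Rep (N * m + 1 + i)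
  reachedBy⇒Rep {N} {i} {B} 2B≤N+1 p with j , j≤B , hit ← inRange⁻ m B _ p =
    a , B , j , j≤B , +-cancelʳ-≡ (B * δ) _ _ (begin-equality
      a * m + B * g + j + B * δ  ≡⟨ Rep-shift a B j refl ⟩
      (a + B + B) * m + j        ≡⟨ cong (λ u → u * m + j) a+2B≡N+1 ⟩
      suc N * m + j              ≡⟨ reassoc (N * m) m j ⟩
      N * m + (m + j)            ≡⟨ cong (N * m +_) hit ⟨
      N * m + (i + 1 + B * δ)    ≡⟨ reassoc′ (N * m) i (B * δ) ⟩
      N * m + 1 + i + B * δ      ∎)
    where
    a = suc N ∸ (B + B)
    a+2B≡N+1 : a + B + B ≡ suc N
    a+2B≡N+1 = trans (+-assoc a B B) (m∸n+n≡m 2B≤N+1)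
    reassoc : ∀ A m j → m + A + j ≡ A + (m + j)
    reassoc = solve-∀
    reassoc′ : ∀ A i D → A + (i + 1 + D) ≡ A + 1 + i + D
    reassoc′ = solve-∀

  reachedWithin⇒Rep : ∀ {N K i} → K + K ≤ suc N → T (reachedWithin K i) → Rep (N * m + 1 + i)
  reachedWithin⇒Rep {K = K} 2K≤N+1 p with B , B≤K , q ← reachedWithin⁻ K p =
    reachedBy⇒Rep (≤-trans (+-mono-≤ B≤K B≤K) 2K≤N+1) q

  block-membership : ∀ N K {i} → K + K ≤ suc N → suc N ≤ suc (K + K) → suc N ≤ k + k → i < m →
                     rep gens (N * m + 1 + i) ≡ reachedWithin K i
  block-membership N K {i} 2K≤N+1 N+1≤2K+1 N+1≤2k i<m = T-ext member⇒ member⇐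
    where
    Rep⇒reachedWithin : Rep (N * m + 1 + i) → T (reachedWithin K i)
    Rep⇒reachedWithin (a , B , j , j≤B , eq) =
      few-summands⇒reachedWithin {K = K} {a = a} N+1≤2K+1 i<m (Rep-summands≤k {a = a} N+1≤2k i<m eq) j≤B eq
    member⇒ : T (rep gens (N * m + 1 + i)) → T (reachedWithin K i)
    member⇒ p = Rep⇒reachedWithin (rep⇒Rep (N * m + 1 + i) p)
    member⇐ : T (reachedWithin K i) → T (rep gens (N * m + 1 + i))
    member⇐ p = Rep⇒rep (N * m + 1 + i) (reachedWithin⇒Rep {K = K} 2K≤N+1 p)

  top-block-summands : ∀ {i a B j} → i < m → k < B → a * m + B * g + j ≡ (k + k) * m + 1 + i → a ≡ 0 × B ≡ suc k
  top-block-summands {i} {suc a′} {B} {j} i<m k<B eq = ⊥-elim (<-irrefl refl (begin-strict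
    m + suc k * g                  ≤⟨ +-mono-≤ (m≤m+n m (a′ * m)) (*-monoˡ-≤ g k<B) ⟩
    suc a′ * m + B * g             ≤⟨ m≤m+n _ j ⟩
    suc a′ * m + B * g + j         ≡⟨ eq ⟩
    (k + k) * m + 1 + i            ≤⟨ block-end (k + k) i<m ⟩
    suc (k + k) * m                <⟨ [2k+1]m<m+[k+1]g ⟩
    m + suc k * g                  ∎))
  top-block-summands {i} {zero} {B} {j} i<m k<B eq with B ≤? suc k
  ... | yes B≤k+1 = refl , ≤-antisym B≤k+1 k<B
  ... | no B≰k+1 = ⊥-elim (<-irrefl refl (begin-strict
    suc (suc k) * g      ≤⟨ *-monoˡ-≤ g (≰⇒> B≰k+1) ⟩
    B * g                ≤⟨ Rep-bound 0 B j eq ⟩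
    (k + k) * m + 1 + i  ≤⟨ block-end (k + k) i<m ⟩
    suc (k + k) * m      <⟨ [2k+1]m<[k+2]g ⟩
    suc (suc k) * g      ∎))

  top-shift : ∀ j → suc k * g + j + δ ≡ (k + k) * m + (m + 2 + j)
  top-shift j = begin-equality
    suc k * g + j + δ          ≡⟨ +-comm-last (suc k * g) j δ ⟩
    suc k * g + δ + j          ≡⟨ cong (_+ j) [k+1]g+δ≡[2k+1]m+2 ⟩
    suc (k + k) * m + 2 + j    ≡⟨ reassoc ((k + k) * m) m j ⟩
    (k + k) * m + (m + 2 + j)  ∎
    where
    +-comm-last : ∀ x y z → x + y + z ≡ x + z + y
    +-comm-last = solve-∀
    reassoc : ∀ A m j → m + A + 2 + j ≡ A + (m + 2 + j)
    reassoc = solve-∀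

  block-shift : ∀ N i → N * m + 1 + i + δ ≡ N * m + (i + 1 + δ)
  block-shift N i = reassoc (N * m) i δ
    where
    reassoc : ∀ A i D → A + 1 + i + D ≡ A + (i + 1 + D)
    reassoc = solve-∀

  top-block-membership : ∀ {i} → i < m → rep gens ((k + k) * m + 1 + i) ≡ (reachedWithin k i ∨ reachedTop i)
  top-block-membership {i} i<m = T-ext member⇒ member⇐
    where
    Rep⇒reached : Rep ((k + k) * m + 1 + i) → T (reachedWithin k i ∨ reachedTop i)
    Rep⇒reached (a , B , j , j≤B , eq) with B ≤? k
    ... | yes B≤k = ∨-introˡ {reachedWithin k i} (few-summands⇒reachedWithin {K = k} {a = a} ≤-refl i<m B≤k j≤B eq)
    ... | no B≰k with refl , refl ← top-block-summands {a = a} i<m (≰⇒> B≰k) eq =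
      ∨-introʳ {reachedWithin k i} (subst (T ∘ inRange (m + 2) (suc k)) (sym hit) (inRange⁺ (m + 2) (suc k) j j≤B))
      where
      hit : i + 1 + δ ≡ m + 2 + j
      hit = +-cancelˡ-≡ ((k + k) * m) _ _
              (trans (sym (block-shift (k + k) i)) (trans (cong (_+ δ) (sym eq)) (top-shift j)))
    member⇒ : T (rep gens ((k + k) * m + 1 + i)) → T (reachedWithin k i ∨ reachedTop i)
    member⇒ p = Rep⇒reached (rep⇒Rep _ p)
    member⇐ : T (reachedWithin k i ∨ reachedTop i) → T (rep gens ((k + k) * m + 1 + i))
    member⇐ p with ∨-elim {reachedWithin k i} p
    ... | inj₁ q = Rep⇒rep ((k + k) * m + 1 + i) (reachedWithin⇒Rep {K = k} (n≤1+n _) q)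
    ... | inj₂ q with j , j≤k+1 , hit ← inRange⁻ (m + 2) (suc k) _ q =
      Rep⇒rep ((k + k) * m + 1 + i) (0 , suc k , j , j≤k+1 , +-cancelʳ-≡ δ _ _
        (trans (top-shift j) (trans (cong ((k + k) * m +_) (sym hit)) (sym (block-shift (k + k) i)))))

  -- Counting block by block

  tally-reachedBy : ∀ {B} → B ≤ k → tally (reachedBy B) m ≡ suc B
  tally-reachedBy {B} B≤k =
    subst (λ n → tally (reachedBy B) n ≡ suc B) end≡m (tally-inRange m B (B * δ) lo (B * (k' + 4 + τ)) lo+1+Bδ≡m)
    where
    lo = (k ∸ B) * δ + 1
    lo+1+Bδ≡m : lo + 1 + B * δ ≡ m
    lo+1+Bδ≡m = begin-equality
      (k ∸ B) * δ + 1 + 1 + B * δ  ≡⟨ regroup (k ∸ B) B δ ⟩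
      (k ∸ B + B) * δ + 2          ≡⟨ cong (λ u → u * δ + 2) (m∸n+n≡m B≤k) ⟩
      k * δ + 2                    ≡⟨ m≡ ⟨
      m                            ∎
      where
      regroup : ∀ d B D → d * D + 1 + 1 + B * D ≡ (d + B) * D + 2
      regroup = solve-∀
    end≡m : lo + suc B + B * (k' + 4 + τ) ≡ m
    end≡m = trans (regroup lo B (k' + 4 + τ)) lo+1+Bδ≡m
      where
      regroup : ∀ lo B D → lo + suc B + B * D ≡ lo + 1 + B * suc D
      regroup = solve-∀

  tally-reachedTop : tally reachedTop m ≡ suc (suc k)
  tally-reachedTop =
    subst (λ n → tally reachedTop n ≡ suc (suc k)) end≡m (tally-inRange (m + 2) (suc k) δ (k' * δ + 3) (τ + 1) lo+1+δ≡)
    where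
    lo+1+δ≡ : k' * δ + 3 + 1 + δ ≡ m + 2
    lo+1+δ≡ = trans (regroup k' τ) (cong (_+ 2) (sym m≡))
      where
      regroup : ∀ k' τ → k' * (suc k' + 4 + τ) + 3 + 1 + (suc k' + 4 + τ) ≡ suc k' * (suc k' + 4 + τ) + 2 + 2
      regroup = solve-∀
    end≡m : k' * δ + 3 + suc (suc k) + (τ + 1) ≡ m
    end≡m = trans (regroup k' τ) (sym m≡)
      where
      regroup : ∀ k' τ → k' * (suc k' + 4 + τ) + 3 + suc (suc (suc k')) + (τ + 1) ≡ suc k' * (suc k' + 4 + τ) + 2
      regroup = solve-∀

  reachedBy-< : ∀ {i B B'} → B < B' → B' ≤ k → T (reachedBy B i) → ¬ T (reachedBy B' i)
  reachedBy-< {i} {B} {B'} B<B' B'≤k p p'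
    with j , _ , hit ← inRange⁻ m B _ p | j' , j'≤B' , hit' ← inRange⁻ m B' _ p' = <-irrefl refl (begin-strict
    m + B'               <⟨ +-monoʳ-< m (≤-<-trans B'≤k k<δ) ⟩
    m + δ                ≤⟨ +-monoˡ-≤ δ (m≤m+n m j) ⟩
    m + j + δ            ≡⟨ cong (_+ δ) hit ⟨
    i + 1 + B * δ + δ    ≡⟨ +-assoc (i + 1) (B * δ) δ ⟩
    i + 1 + (B * δ + δ)  ≡⟨ cong (i + 1 +_) (+-comm (B * δ) δ) ⟩
    i + 1 + suc B * δ    ≤⟨ +-monoʳ-≤ (i + 1) (*-monoˡ-≤ δ B<B') ⟩
    i + 1 + B' * δ       ≡⟨ hit' ⟩
    m + j'               ≤⟨ +-monoʳ-≤ m j'≤B' ⟩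
    m + B'               ∎)

  reachedBy-reachedTop : ∀ {i B} → T (reachedBy B i) → ¬ T (reachedTop i)
  reachedBy-reachedTop {i} {zero} p p'
    with j , _ , hit ← inRange⁻ m 0 _ p | j' , j'≤ , hit' ← inRange⁻ (m + 2) (suc k) _ p' = <-irrefl refl (begin-strict
    m + 2 + suc k        <⟨ ≤-reflexive (regroup m k) ⟩
    m + (k + 4)          ≤⟨ +-monoʳ-≤ m k+4≤δ ⟩
    m + δ                ≤⟨ +-monoˡ-≤ δ (m≤m+n m j) ⟩
    m + j + δ            ≡⟨ cong (_+ δ) (trans (sym (+-identityʳ (i + 1))) hit) ⟨
    i + 1 + δ            ≡⟨ hit' ⟩
    m + 2 + j'           ≤⟨ +-monoʳ-≤ (m + 2) j'≤ ⟩
    m + 2 + suc k        ∎)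
    where
    regroup : ∀ m k → suc (m + 2 + suc k) ≡ m + (k + 4)
    regroup = solve-∀
  reachedBy-reachedTop {i} {suc B} p p'
    with j , j≤B , hit ← inRange⁻ m (suc B) _ p | j' , _ , hit' ← inRange⁻ (m + 2) (suc k) _ p' = <-irrefl refl (begin-strict
    m + suc B            ≤⟨ +-monoʳ-≤ m (s≤s (m≤m*n B δ)) ⟩
    m + suc (B * δ)      <⟨ ≤-reflexive (regroup m (B * δ)) ⟩
    m + 2 + B * δ        ≤⟨ +-monoˡ-≤ (B * δ) (m≤m+n (m + 2) j') ⟩
    m + 2 + j' + B * δ   ≡⟨ cong (_+ B * δ) hit' ⟨
    i + 1 + δ + B * δ    ≡⟨ +-assoc (i + 1) δ (B * δ) ⟩
    i + 1 + suc B * δ    ≡⟨ hit ⟩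
    m + j                ≤⟨ +-monoʳ-≤ m j≤B ⟩
    m + suc B            ∎)
    where
    regroup : ∀ a b → suc (a + suc b) ≡ a + 2 + b
    regroup = solve-∀

  tally-reachedWithin : ∀ {K} → K ≤ k → tally (reachedWithin K) m ≡ triangle (suc K)
  tally-reachedWithin {zero}  _    = tally-reachedBy z≤n
  tally-reachedWithin {suc K} K<k =
    trans (tally-∨ (reachedWithin K) (reachedBy (suc K)) m (λ i _ → ¬T⇒≡false (disjoint i)))
          (cong₂ _+_ (tally-reachedWithin (<⇒≤ K<k)) (tally-reachedBy K<k))
    where
    disjoint : ∀ i → ¬ T (reachedWithin K i ∧ reachedBy (suc K) i)
    disjoint i p with q , q' ← ∧-elim {reachedWithin K i} p with B , B≤K , r ← reachedWithin⁻ K q =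
      reachedBy-< (s≤s B≤K) K<k r q'

  tally-top-block : tally (λ i → reachedWithin k i ∨ reachedTop i) m ≡ triangle (suc k) + suc (suc k)
  tally-top-block =
    trans (tally-∨ (reachedWithin k) reachedTop m (λ i _ → ¬T⇒≡false (disjoint i)))
          (cong₂ _+_ (tally-reachedWithin ≤-refl) tally-reachedTop)
    where
    disjoint : ∀ i → ¬ T (reachedWithin k i ∧ reachedTop i)
    disjoint i p with q , q' ← ∧-elim {reachedWithin k i} p with B , _ , r ← reachedWithin⁻ k q =
      reachedBy-reachedTop r q'

  unreached-gap : ∀ K {i} → m ≤ i + 2 + τ → i + 1 < m → reachedWithin K i ≡ false
  unreached-gap K {i} m≤ i+1<m = ¬T⇒≡false unreached
    where
    unreachedBy : ∀ B → ¬ T (reachedBy B i)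
    unreachedBy zero p with j , _ , hit ← inRange⁻ m 0 _ p = <-irrefl refl (begin-strict
      i + 1          <⟨ i+1<m ⟩
      m              ≤⟨ m≤m+n m j ⟩
      m + j          ≡⟨ hit ⟨
      i + 1 + 0 * δ  ≡⟨ +-identityʳ (i + 1) ⟩
      i + 1          ∎)
    unreachedBy (suc B) p with j , j≤B , hit ← inRange⁻ m (suc B) _ p = <-irrefl refl (begin-strict
      m + suc B                <⟨ ≤-reflexive (regroup′ m B) ⟩
      m + 2 + B                ≤⟨ +-monoˡ-≤ B (+-monoˡ-≤ 2 m≤) ⟩
      i + 2 + τ + 2 + B        ≡⟨ regroup i τ B ⟨
      i + 1 + (τ + 3) + B      ≤⟨ +-mono-≤ (+-monoʳ-≤ (i + 1) τ+3≤δ) (m≤m*n B δ) ⟩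
      i + 1 + δ + B * δ        ≡⟨ +-assoc (i + 1) δ (B * δ) ⟩
      i + 1 + suc B * δ        ≡⟨ hit ⟩
      m + j                    ≤⟨ +-monoʳ-≤ m j≤B ⟩
      m + suc B                ∎)
      where
      regroup : ∀ i τ B → i + 1 + (τ + 3) + B ≡ i + 2 + τ + 2 + B
      regroup = solve-∀
      regroup′ : ∀ m B → suc (m + suc B) ≡ m + 2 + B
      regroup′ = solve-∀
    unreached : ¬ T (reachedWithin K i)
    unreached p with B , _ , q ← reachedWithin⁻ K p = unreachedBy B q

  unreachedTop-gap : ∀ {i} → suc m ≤ i + 2 + τ → reachedTop i ≡ false
  unreachedTop-gap {i} m<i+2+τ = ¬T⇒≡false unreached
    where
    unreached : ¬ T (reachedTop i)
    unreached p with j , j≤ , hit ← inRange⁻ (m + 2) (suc k) _ p = <-irrefl refl (begin-strict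
      m + 2 + suc k          <⟨ ≤-reflexive (regroup m k) ⟩
      suc m + (k + 3)        ≤⟨ +-monoˡ-≤ (k + 3) m<i+2+τ ⟩
      i + 2 + τ + (k + 3)    ≡⟨ regroup′ i k τ ⟨
      i + 1 + δ              ≡⟨ hit ⟩
      m + 2 + j              ≤⟨ +-monoʳ-≤ (m + 2) j≤ ⟩
      m + 2 + suc k          ∎)
      where
      regroup : ∀ m k → suc (m + 2 + suc k) ≡ suc m + (k + 3)
      regroup = solve-∀
      regroup′ : ∀ i k τ → i + 1 + (k + 4 + τ) ≡ i + 2 + τ + (k + 3)
      regroup′ = solve-∀

  repCount : ℕ → ℕ
  repCount = tally (rep gens)

  tally-block : ∀ N K → K + K ≤ suc N → suc N ≤ suc (K + K) → suc N ≤ k + k →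
                tally (λ i → rep gens (N * m + 1 + i)) m ≡ triangle (suc K)
  tally-block N K 2K≤N+1 N+1≤2K+1 N+1≤2k =
    trans (tally-cong m (λ i i<m → block-membership N K 2K≤N+1 N+1≤2K+1 N+1≤2k i<m))
          (tally-reachedWithin (double≤odd⇒≤ (≤-trans 2K≤N+1 (≤-trans N+1≤2k (n≤1+n _)))))

  repCount-block : ∀ N K → K + K ≤ suc N → suc N ≤ suc (K + K) → suc N ≤ k + k →
                   repCount (N * m + 1 + m) ≡ repCount (N * m + 1) + triangle (suc K)
  repCount-block N K 2K≤N+1 N+1≤2K+1 N+1≤2k =
    trans (tally-+ (rep gens) (N * m + 1) m) (cong (repCount (N * m + 1) +_) (tally-block N K 2K≤N+1 N+1≤2K+1 N+1≤2k))

  rep-multiple : ∀ a → rep gens (a * m) ≡ true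
  rep-multiple a = T⇒≡true (Rep⇒rep (a * m) (a , 0 , 0 , z≤n , trans (+-identityʳ _) (+-identityʳ _)))

  -- Blocks 2K − 1 and 2K contain triangle K + triangle (K + 1) = (K + 1)² elements of S;
  -- before block 0 there is only 0.
  repCount-blocks : ∀ K → K ≤ k → repCount ((K + K) * m + 1) ≡ squarePyramidal (suc K)
  repCount-blocks zero    _   = cong (λ b → indicator b + 0) (rep-multiple 0)
  repCount-blocks (suc K) K<k = begin-equality
    repCount ((suc K + suc K) * m + 1)
      ≡⟨ cong repCount (regroup K m) ⟩
    repCount (suc (K + K) * m + 1 + m)
      ≡⟨ repCount-block (suc (K + K)) (suc K) (≤-reflexive 2K+2≡)
                        (≤-trans (≤-reflexive (sym 2K+2≡)) (n≤1+n _))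
                        (≤-trans (≤-reflexive (sym 2K+2≡)) (+-mono-≤ K<k K<k)) ⟩
    repCount (suc (K + K) * m + 1) + triangle (suc (suc K))
      ≡⟨ cong (λ u → repCount u + triangle (suc (suc K))) (regroup′ K m) ⟩
    repCount ((K + K) * m + 1 + m) + triangle (suc (suc K))
      ≡⟨ cong (_+ triangle (suc (suc K))) (repCount-block (K + K) K (n≤1+n _) ≤-refl (+-mono-≤ K<k (<⇒≤ K<k))) ⟩
    repCount ((K + K) * m + 1) + triangle (suc K) + triangle (suc (suc K))
      ≡⟨ cong (λ u → u + triangle (suc K) + triangle (suc (suc K))) (repCount-blocks K (<⇒≤ K<k)) ⟩
    squarePyramidal (suc K) + triangle (suc K) + triangle (suc (suc K))
      ≡⟨ +-assoc (squarePyramidal (suc K)) _ _ ⟩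
    squarePyramidal (suc K) + (triangle (suc K) + triangle (suc (suc K)))
      ≡⟨ cong (squarePyramidal (suc K) +_) (triangle-+-triangle-suc (suc K)) ⟩
    squarePyramidal (suc (suc K)) ∎
    where
    regroup : ∀ K m → (suc K + suc K) * m + 1 ≡ suc (K + K) * m + 1 + m
    regroup = solve-∀
    regroup′ : ∀ K m → suc (K + K) * m + 1 ≡ (K + K) * m + 1 + m
    regroup′ = solve-∀
    2K+2≡ : suc K + suc K ≡ suc (suc (K + K))
    2K+2≡ = cong suc (+-suc K K)

  c+j≡ : ∀ j → c + j ≡ (k' + k) * m + 1 + (e + 1 + j)
  c+j≡ j = trans (cong (_+ j) c≡[2k-1]m+2+e) (regroup ((k' + k) * m) e j)
    where
    regroup : ∀ A e j → A + 2 + e + j ≡ A + 1 + (e + 1 + j)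
    regroup = solve-∀

  c+m+j≡ : ∀ j → c + m + j ≡ (k + k) * m + 1 + (e + 1 + j)
  c+m+j≡ j = trans (cong (λ u → u + m + j) c≡[2k-1]m+2+e) (regroup k' e m j)
    where
    regroup : ∀ k' e m j → (k' + suc k') * m + 2 + e + m + j ≡ (suc k' + suc k') * m + 1 + (e + 1 + j)
    regroup = solve-∀

  gap-position+2+τ : ∀ j → e + 1 + j + 2 + τ ≡ m + suc j
  gap-position+2+τ j = trans (regroup e j τ) (cong (_+ suc j) τ+2+e≡m)
    where
    regroup : ∀ e j τ → e + 1 + j + 2 + τ ≡ τ + 2 + e + suc j
    regroup = solve-∀

  m<gap-position+2+τ : ∀ j → m < e + 1 + j + 2 + τ
  m<gap-position+2+τ j = subst (m <_) (sym (trans (gap-position+2+τ j) (+-suc m j))) (s≤s (m≤m+n m j))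

  gap-position+1<m : ∀ {j} → j < τ → e + 1 + j + 1 < m
  gap-position+1<m {j} j<τ = begin
    suc (e + 1 + j + 1)  ≡⟨ regroup e j ⟩
    e + 2 + suc j        ≤⟨ +-monoʳ-≤ (e + 2) j<τ ⟩
    e + 2 + τ            ≡⟨ regroup′ e τ ⟩
    τ + 2 + e            ≡⟨ τ+2+e≡m ⟩
    m                    ∎
    where
    regroup : ∀ e j → suc (e + 1 + j + 1) ≡ e + 2 + suc j
    regroup = solve-∀
    regroup′ : ∀ e τ → e + 2 + τ ≡ τ + 2 + e
    regroup′ = solve-∀

  gap-position<m : ∀ {j} → j < τ → e + 1 + j < m
  gap-position<m j<τ = <-trans (m<m+n _ z<s) (gap-position+1<m j<τ)

  unrep-after-c : ∀ {j} → j < τ → rep gens (c + j) ≡ false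
  unrep-after-c {j} j<τ =
    trans (cong (rep gens) (c+j≡ j))
   (trans (block-membership (k' + k) k ≤-refl (n≤1+n _) ≤-refl (gap-position<m j<τ))
          (unreached-gap k (<⇒≤ (m<gap-position+2+τ j)) (gap-position+1<m j<τ)))

  unrep-after-c+m : ∀ {j} → j < τ → rep gens (c + m + j) ≡ false
  unrep-after-c+m {j} j<τ =
    trans (cong (rep gens) (c+m+j≡ j))
   (trans (top-block-membership (gap-position<m j<τ))
          (cong₂ _∨_ (unreached-gap k (<⇒≤ (m<gap-position+2+τ j)) (gap-position+1<m j<τ))
                     (unreachedTop-gap {e + 1 + j} (m<gap-position+2+τ j))))

  tally-after-c : tally (λ i → rep gens (c + i)) (τ + 1) ≡ 1
  tally-after-c = tally-last _ τ (λ _ → unrep-after-c) (trans (cong (rep gens) c+τ≡[k+k]m) (rep-multiple (k + k)))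

  tally-after-c+m : tally (λ i → rep gens (c + m + i)) (τ + 1) ≡ 1
  tally-after-c+m = tally-last _ τ (λ _ → unrep-after-c+m) (trans (cong (rep gens) c+m+τ≡) (rep-multiple (suc (k + k))))
    where
    c+m+τ≡ : c + m + τ ≡ suc (k + k) * m
    c+m+τ≡ = trans (trans (+-assoc c m τ) (cong (c +_) (+-comm m τ))) (trans (sym (+-assoc c τ m))
                   (trans (cong (_+ m) c+τ≡[k+k]m) (+-comm ((k + k) * m) m)))

  repCount-c : repCount c + 1 ≡ squarePyramidal (suc k)
  repCount-c = begin-equality
    repCount c + 1                                       ≡⟨ cong (repCount c +_) tally-after-c ⟨
    repCount c + tally (λ i → rep gens (c + i)) (τ + 1)  ≡⟨ tally-+ (rep gens) c (τ + 1) ⟨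
    repCount (c + (τ + 1))                               ≡⟨ cong repCount (+-assoc c τ 1) ⟨
    repCount (c + τ + 1)                                 ≡⟨ cong (λ u → repCount (u + 1)) c+τ≡[k+k]m ⟩
    repCount ((k + k) * m + 1)                           ≡⟨ repCount-blocks k ≤-refl ⟩
    squarePyramidal (suc k)                              ∎

  tally-after-conductor : tally (λ i → rep gens (c + i)) m ≡ triangle (suc k) + suc (suc k)
  tally-after-conductor = +-cancelˡ-≡ (repCount c + 1) _ _ (begin-equality
    repCount c + 1 + tally (λ i → rep gens (c + i)) m
      ≡⟨ +-comm-last (repCount c) 1 _ ⟩
    repCount c + tally (λ i → rep gens (c + i)) m + 1
      ≡⟨ cong₂ _+_ (tally-+ (rep gens) c m) tally-after-c+m ⟨
    repCount (c + m) + tally (λ i → rep gens (c + m + i)) (τ + 1)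
      ≡⟨ tally-+ (rep gens) (c + m) (τ + 1) ⟨
    repCount (c + m + (τ + 1))
      ≡⟨ cong repCount (regroup c m τ) ⟩
    repCount (c + τ + 1 + m)
      ≡⟨ cong (λ u → repCount (u + 1 + m)) c+τ≡[k+k]m ⟩
    repCount ((k + k) * m + 1 + m)
      ≡⟨ tally-+ (rep gens) ((k + k) * m + 1) m ⟩
    repCount ((k + k) * m + 1) + tally (λ i → rep gens ((k + k) * m + 1 + i)) m
      ≡⟨ cong₂ _+_ (trans (repCount-blocks k ≤-refl) (sym repCount-c))
                   (trans (tally-cong m (λ i → top-block-membership)) tally-top-block) ⟩
    repCount c + 1 + (triangle (suc k) + suc (suc k)) ∎)
    where
    +-comm-last : ∀ a b c → a + b + c ≡ a + c + b
    +-comm-last = solve-∀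
    regroup : ∀ c m τ → c + m + (τ + 1) ≡ c + τ + 1 + m
    regroup = solve-∀

  -- Minimal generators, conductor and multiplicity

  S : Subsetℕ
  S = ⟨ gens ⟩ c

  S-below-c : ∀ {x} → x < c → S x ≡ rep gens x
  S-below-c {x} x<c = cong (_∨ rep gens x) (¬T⇒≡false (λ c≤x → <⇒≱ x<c (≤ᵇ⇒≤ c x c≤x)))

  S-above-c : ∀ {x} → c ≤ x → S x ≡ true
  S-above-c {x} c≤x = T⇒≡true (∨-introˡ {c ≤ᵇ x} (≤⇒≤ᵇ c≤x))

  R⇒S : ∀ {x} → R x → T (S x)
  R⇒S {x} r = ∨-introʳ {c ≤ᵇ x} (rep₃⁺ m g (suc g) x r)

  S⇒R : ∀ {x} → x < c → T (S x) → R x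
  S⇒R {x} x<c p = rep₃⁻ m g (suc g) x (subst T (S-below-c x<c) p)

  isGenerator : ℕ → Bool
  isGenerator x = (x ≡ᵇ m) ∨ ((x ≡ᵇ g) ∨ (x ≡ᵇ suc g))

  m-isGenerator : T (isGenerator m)
  m-isGenerator = ∨-introˡ {m ≡ᵇ m} (≡⇒≡ᵇ m m refl)

  generator-cases : ∀ {y} → T (isGenerator y) → y ≡ m ⊎ y ≡ g ⊎ y ≡ suc g
  generator-cases {y} p with ∨-elim {y ≡ᵇ m} p
  ... | inj₁ q = inj₁ (≡ᵇ⇒≡ y m q)
  ... | inj₂ q with ∨-elim {y ≡ᵇ g} q
  ...   | inj₁ r = inj₂ (inj₁ (≡ᵇ⇒≡ y g r))
  ...   | inj₂ r = inj₂ (inj₂ (≡ᵇ⇒≡ y (suc g) r))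

  generator-R : ∀ {y} → T (isGenerator y) → R y
  generator-R {y} p with generator-cases {y} p
  ... | inj₁ refl        = 1 , 0 , 0 , trans (+-identityʳ _) (trans (+-identityʳ _) (+-identityʳ m))
  ... | inj₂ (inj₁ refl) = 0 , 1 , 0 , trans (+-identityʳ _) (+-identityʳ g)
  ... | inj₂ (inj₂ refl) = 0 , 0 , 1 , +-identityʳ (suc g)

  generator-bounds : ∀ {y} → T (isGenerator y) → m ≤ y × y ≤ suc g
  generator-bounds {y} p with generator-cases {y} p
  ... | inj₁ refl        = ≤-refl , ≤-trans (<⇒≤ m<g) (n≤1+n g)
  ... | inj₂ (inj₁ refl) = <⇒≤ m<g , n≤1+n g
  ... | inj₂ (inj₂ refl) = ≤-trans (<⇒≤ m<g) (n≤1+n g) , ≤-refl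

  peel-generator : ∀ {z} → R z → 0 < z → Σ ℕ λ y → T (isGenerator y) × Σ ℕ λ w → R w × y + w ≡ z
  peel-generator (suc a , b , l , refl) _ =
    m , m-isGenerator , _ , (a , b , l , refl) , regroup a m (b * g) (l * suc g)
    where
    regroup : ∀ a m x y → m + (a * m + x + y) ≡ suc a * m + x + y
    regroup = solve-∀
  peel-generator (zero , suc b , l , refl) _ =
    g , ∨-introʳ {g ≡ᵇ m} (∨-introˡ {g ≡ᵇ g} (≡⇒≡ᵇ g g refl)) , _ , (0 , b , l , refl) , regroup b g (l * suc g)
    where
    regroup : ∀ b g y → g + (0 + b * g + y) ≡ 0 + suc b * g + y
    regroup = solve-∀
  peel-generator (zero , zero , suc l , refl) _ =
    suc g , ∨-introʳ {suc g ≡ᵇ m} (∨-introʳ {suc g ≡ᵇ g} (≡⇒≡ᵇ (suc g) (suc g) refl)) , _ , (0 , 0 , l , refl) , refl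

  R-positive⇒m≤ : ∀ {x} → R x → 0 < x → m ≤ x
  R-positive⇒m≤ r 0<x with y , gen , w , _ , refl ← peel-generator r 0<x =
    ≤-trans (proj₁ (generator-bounds {y} gen)) (m≤m+n y w)

  S-positive⇒m≤ : ∀ {x} → 0 < x → T (S x) → m ≤ x
  S-positive⇒m≤ {x} 0<x p = by-cases (x <? c)
    where
    by-cases : Dec (x < c) → m ≤ x
    by-cases (yes x<c) = R-positive⇒m≤ (S⇒R x<c p) 0<x
    by-cases (no x≮c)  = ≤-trans (<⇒≤ m<c) (≮⇒≥ x≮c)

  decomposable : ℕ → Bool
  decomposable z = any (λ a → (0 <ᵇ a) ∧ S a ∧ S (z ∸ a)) (upTo z)

  Decomposition : ℕ → Set
  Decomposition z = Σ ℕ λ y → Σ ℕ λ w → 0 < y × 0 < w × T (S y) × T (S w) × y + w ≡ z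

  decomposable⁻ : ∀ {z} → T (decomposable z) → Decomposition z
  decomposable⁻ {z} p = split (any-upTo⁻ _ z p)
    where
    split : (∃ λ y → y < z × T ((0 <ᵇ y) ∧ S y ∧ S (z ∸ y))) → Decomposition z
    split (y , y<z , q) with q₁ , q₂ ← ∧-elim {0 <ᵇ y} q with q₃ , q₄ ← ∧-elim {S y} q₂ =
      y , z ∸ y , <ᵇ⇒< 0 y q₁ , m<n⇒0<n∸m y<z , q₃ , q₄ , m+[n∸m]≡n (<⇒≤ y<z)

  decomposable⁺ : ∀ {y w} → 0 < y → 0 < w → T (S y) → T (S w) → T (decomposable (y + w))
  decomposable⁺ {y} {w} 0<y 0<w p q =
    any-upTo⁺ _ (m<m+n y 0<w) (∧-intro {0 <ᵇ y} (<⇒<ᵇ 0<y) (∧-intro {S y} p (subst (T ∘ S) (sym (m+n∸m≡n y w)) q)))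

  decomposition⇒R : ∀ {z} → z < c + m → Decomposition z → R z
  decomposition⇒R z<c+m (y , w , 0<y , 0<w , Sy , Sw , refl) =
    Rep₃-+ (S⇒R (below-c (S-positive⇒m≤ 0<w Sw) refl) Sy) (S⇒R (below-c (S-positive⇒m≤ 0<y Sy) (+-comm w y)) Sw)
    where
    below-c : ∀ {u v} → m ≤ v → u + v ≡ y + w → u < c
    below-c {u} {v} m≤v u+v≡ = +-cancelʳ-< m u c (begin-strict
      u + m  ≤⟨ +-monoʳ-≤ u m≤v ⟩
      u + v  ≡⟨ u+v≡ ⟩
      y + w  <⟨ z<c+m ⟩
      c + m  ∎)

  R⇒decomposable : ∀ {z} → suc g < z → R z → T (decomposable z)
  R⇒decomposable {z} g+1<z r with y , gen , w , rw , refl ← peel-generator r (≤-<-trans z≤n g+1<z) =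
    decomposable⁺ {y} {w} (<-≤-trans 0<m m≤y) 0<w (R⇒S (generator-R {y} gen)) (R⇒S rw)
    where
    m≤y = proj₁ (generator-bounds {y} gen)
    0<w : 0 < w
    0<w = +-cancelˡ-< y 0 w (begin-strict
      y + 0   ≡⟨ +-identityʳ y ⟩
      y       ≤⟨ proj₂ (generator-bounds {y} gen) ⟩
      suc g   <⟨ g+1<z ⟩
      y + w   ∎)

  indecomposable-below-2m : ∀ {z} → z < m + m → ¬ T (decomposable z)
  indecomposable-below-2m {z} z<2m = too-small ∘ decomposable⁻
    where
    too-small : ¬ Decomposition z
    too-small (y , w , 0<y , 0<w , Sy , Sw , refl) =
      <⇒≱ z<2m (+-mono-≤ (S-positive⇒m≤ 0<y Sy) (S-positive⇒m≤ 0<w Sw))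

  not-isMinGen : ∀ {x} → S x ≡ true → (x ≡ᵇ 0) ≡ false → not (isMinGen S x) ≡ decomposable x
  not-isMinGen {x} Sx x≢0 = simplify (S x) (x ≡ᵇ 0) (decomposable x) Sx x≢0
    where
    simplify : ∀ a b d → a ≡ true → b ≡ false → not (a ∧ not b ∧ not d) ≡ d
    simplify true false d _ _ = not-involutive d

  not-isMinGen-after-c : ∀ {i} → i < m → not (isMinGen S (c + i)) ≡ rep gens (c + i)
  not-isMinGen-after-c {i} i<m =
    trans (not-isMinGen (S-above-c (m≤m+n c i)) c+i≢0)
          (T-ext (rep₃⁺ m g (suc g) (c + i) ∘ decomposition⇒R (+-monoʳ-< c i<m) ∘ decomposable⁻)
                 (R⇒decomposable g+1<c+i ∘ rep₃⁻ m g (suc g) (c + i)))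
    where
    g+1<c+i : suc g < c + i
    g+1<c+i = <-≤-trans g+1<c (m≤m+n c i)
    c+i≢0 : (c + i ≡ᵇ 0) ≡ false
    c+i≢0 = ¬T⇒≡false (λ p → <⇒≢ (<-≤-trans 0<m (≤-trans (<⇒≤ m<c) (m≤m+n c i))) (sym (≡ᵇ⇒≡ (c + i) 0 p)))

  minimal-below-c : ∀ {x} → x < c → (S x ∧ isMinGen S x) ≡ isGenerator x
  minimal-below-c {x} x<c = T-ext minimal⇒generator generator⇒minimal
    where
    minimal⇒generator : T (S x ∧ isMinGen S x) → T (isGenerator x)
    minimal⇒generator p = only-generator (peel-generator (S⇒R x<c Sx) (n≢0⇒n>0 x≢0))
      where
      Sx = proj₁ (∧-elim {S x} p)
      rest = proj₂ (∧-elim {S x} (proj₂ (∧-elim {S x} p)))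
      x≢0 : x ≢ 0
      x≢0 x≡0 = T-not⇒¬T (proj₁ (∧-elim {not (x ≡ᵇ 0)} rest)) (≡⇒≡ᵇ x 0 x≡0)
      indecomposable : ¬ T (decomposable x)
      indecomposable = T-not⇒¬T (proj₂ (∧-elim {not (x ≡ᵇ 0)} rest))
      only-generator : (Σ ℕ λ y → T (isGenerator y) × Σ ℕ λ w → R w × y + w ≡ x) → T (isGenerator x)
      only-generator (y , gen , zero , _ , y+0≡x) = subst (T ∘ isGenerator) (trans (sym (+-identityʳ y)) y+0≡x) gen
      only-generator (y , gen , suc w , rw , y+w≡x) = ⊥-elim (indecomposable (subst (T ∘ decomposable) y+w≡x
        (decomposable⁺ {y} {suc w} (<-≤-trans 0<m (proj₁ (generator-bounds {y} gen))) z<s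
                       (R⇒S (generator-R {y} gen)) (R⇒S rw))))
    generator⇒minimal : T (isGenerator x) → T (S x ∧ isMinGen S x)
    generator⇒minimal gen = ∧-intro {S x} Sx (∧-intro {S x} Sx (∧-intro {not (x ≡ᵇ 0)} x≢0 indecomposable))
      where
      Sx = R⇒S (generator-R {x} gen)
      m≤x = proj₁ (generator-bounds {x} gen)
      x≢0 : T (not (x ≡ᵇ 0))
      x≢0 = ¬T⇒T-not (λ p → <⇒≢ (<-≤-trans 0<m m≤x) (sym (≡ᵇ⇒≡ x 0 p)))
      indecomposable : T (not (decomposable x))
      indecomposable = ¬T⇒T-not (indecomposable-below-2m (≤-<-trans (proj₂ (generator-bounds {x} gen)) g+1<m+m))

  m≡e+2+τ : m ≡ e + 2 + τ
  m≡e+2+τ = trans (sym τ+2+e≡m) (regroup τ e)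
    where
    regroup : ∀ τ e → τ + 2 + e ≡ e + 2 + τ
    regroup = solve-∀

  e+1<m : e + 1 < m
  e+1<m = subst (e + 1 <_) (sym m≡e+2+τ) (≤-trans (≤-reflexive (regroup e)) (m≤m+n (e + 2) τ))
    where
    regroup : ∀ e → suc (e + 1) ≡ e + 2
    regroup = solve-∀

  c-1 : ℕ
  c-1 = (k' + k) * m + 1 + e

  c≡suc[c-1] : c ≡ suc c-1
  c≡suc[c-1] = trans c≡[2k-1]m+2+e (regroup ((k' + k) * m) e)
    where
    regroup : ∀ A e → A + 2 + e ≡ suc (A + 1 + e)
    regroup = solve-∀

  last-gap : rep gens c-1 ≡ false
  last-gap = trans (block-membership (k' + k) k ≤-refl (n≤1+n _) ≤-refl (<-trans (m<m+n e z<s) e+1<m))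
                   (unreached-gap k (≤-reflexive m≡e+2+τ) e+1<m)

  conductor-unique : ∀ {c'} → IsConductor S c' → c' ≡ c
  conductor-unique {c'} (above , least) = ≤-antisym (least c (λ _ → S-above-c)) c≤c'
    where
    c≤c' : c ≤ c'
    c≤c' with c' ≤? c-1
    ... | no c'≰c-1 = subst (_≤ c') (sym c≡suc[c-1]) (≰⇒> c'≰c-1)
    ... | yes c'≤c-1 = ⊥-elim (false≢true (trans (sym gap) (above c-1 c'≤c-1)))
      where
      gap : S c-1 ≡ false
      gap = trans (S-below-c (≤-reflexive (sym c≡suc[c-1]))) last-gap
      false≢true : false ≢ true
      false≢true ()

  multiplicity-unique : ∀ {m'} → IsMultiplicity S m' → m' ≡ m
  multiplicity-unique {m'} (0<m' , Sm' , below) with <-cmp m' m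
  ... | tri< m'<m _ _ = ⊥-elim (<⇒≱ m'<m (S-positive⇒m≤ 0<m' (subst T (sym Sm') _)))
  ... | tri≈ _ m'≡m _ = m'≡m
  ... | tri> _ _ m'>m = ⊥-elim (subst T (below m 0<m m'>m) (R⇒S (generator-R {m} m-isGenerator)))

  ceilDiv-c-m : ceilDiv c m ≡ k + k
  ceilDiv-c-m = subst (λ u → ceilDiv c u ≡ k + k) (sym m≡1+M) (begin-equality
    (c + M) / suc M                              ≡⟨ cong (_/ suc M) c+M≡ ⟩
    ((k + k) * suc M + (e + 1)) / suc M          ≡⟨ +-distrib-/-∣ˡ (e + 1) {suc M} (divides-refl (k + k)) ⟩
    (k + k) * suc M / suc M + (e + 1) / suc M    ≡⟨ cong₂ _+_ (m*n/n≡m (k + k) (suc M)) (m<n⇒m/n≡0 e+1<1+M) ⟩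
    k + k + 0                                    ≡⟨ +-identityʳ (k + k) ⟩
    k + k                                        ∎)
    where
    M = k * δ + 1
    m≡1+M : m ≡ suc M
    m≡1+M = trans m≡ (+-suc (k * δ) 1)
    e+1<1+M : e + 1 < suc M
    e+1<1+M = subst (e + 1 <_) m≡1+M e+1<m
    c+M≡ : c + M ≡ (k + k) * suc M + (e + 1)
    c+M≡ = trans (cong (_+ M) (trans c≡[2k-1]m+2+e (cong (λ u → (k' + k) * u + 2 + e) m≡1+M))) (regroup k' M e)
      where
      regroup : ∀ k' M e → (k' + suc k') * suc M + 2 + e + M ≡ (suc k' + suc k') * suc M + (e + 1)
      regroup = solve-∀

  elements-below-c : List ℕ
  elements-below-c = filter (λ s → T? (S s)) (upTo c)

  count-minimal-below-c : count (isMinGen S) elements-below-c ≡ 3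
  count-minimal-below-c = begin-equality
    count (isMinGen S) elements-below-c        ≡⟨ count-filter (isMinGen S) S (upTo c) ⟩
    count (λ x → S x ∧ isMinGen S x) (upTo c)  ≡⟨ count-applyUpTo _ (λ x → x) c ⟩
    tally (λ x → S x ∧ isMinGen S x) c         ≡⟨ tally-cong c (λ _ → minimal-below-c) ⟩
    tally isGenerator c                        ≡⟨ tally-three-points m<g (n<1+n g) g+1<c ⟩
    3                                          ∎

  length-below-c : length elements-below-c ≡ repCount c
  length-below-c = trans (count-applyUpTo S (λ x → x) c) (tally-cong c (λ _ → S-below-c))

  count-not-minimal-after-c : count (λ z → not (isMinGen S z)) (map (λ i → c + i) (upTo m))
                              ≡ triangle (suc k) + suc (suc k)
  count-not-minimal-after-c = begin-equality
    count (λ z → not (isMinGen S z)) (map (λ i → c + i) (upTo m))  ≡⟨ cong (count _) (map-upTo (λ i → c + i) m) ⟩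
    count (λ z → not (isMinGen S z)) (applyUpTo (λ i → c + i) m)   ≡⟨ count-applyUpTo _ (λ i → c + i) m ⟩
    tally (λ i → not (isMinGen S (c + i))) m                        ≡⟨ tally-cong m (λ _ → not-isMinGen-after-c) ⟩
    tally (λ i → rep gens (c + i)) m                                ≡⟨ tally-after-conductor ⟩
    triangle (suc k) + suc (suc k)                                  ∎

open import Data.Integer using (+_)

-- The Eliahou number

eliahou-by-parts : ∀ S c m {p l q d} →
  count (isMinGen S) (filter (λ s → T? (S s)) (upTo c)) ≡ p →
  length (filter (λ s → T? (S s)) (upTo c)) ≡ l →
  ceilDiv c m ≡ q →
  count (λ z → not (isMinGen S z)) (map (λ i → c + i) (upTo m)) ≡ d →
  eliahou S c m ≡ ((+ p) ℤ.* (+ l) ℤ.- (+ q) ℤ.* (+ d)) ℤ.+ ((+ (q * m)) ℤ.- (+ c))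
eliahou-by-parts S c m refl refl refl refl = refl

eliahou-arithmetic : ∀ L D q m c τ u → 3 * L + (τ + suc u) ≡ q * D → c + τ ≡ q * m →
  ((+ 3) ℤ.* (+ L) ℤ.- (+ q) ℤ.* (+ D)) ℤ.+ ((+ (q * m)) ℤ.- (+ c)) ≡ -[1+ u ]
eliahou-arithmetic L D q m c τ u 3L+h≡qD c+τ≡qm = begin
  ((+ 3) ℤ.* (+ L) ℤ.- (+ q) ℤ.* (+ D)) ℤ.+ ((+ (q * m)) ℤ.- (+ c))
    ≡⟨ cong₂ (λ a b → (a ℤ.- b) ℤ.+ ((+ (q * m)) ℤ.- (+ c))) (ℤ.pos-* 3 L) (ℤ.pos-* q D) ⟨
  ((+ (3 * L)) ℤ.- (+ (q * D))) ℤ.+ ((+ (q * m)) ℤ.- (+ c))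
    ≡⟨ cong₂ (λ a b → ((+ (3 * L)) ℤ.- (+ a)) ℤ.+ ((+ b) ℤ.- (+ c))) 3L+h≡qD c+τ≡qm ⟨
  ((+ (3 * L)) ℤ.- (+ (3 * L + (τ + suc u)))) ℤ.+ ((+ (c + τ)) ℤ.- (+ c))
    ≡⟨ cong₂ (λ a b → ((+ (3 * L)) ℤ.- a) ℤ.+ (b ℤ.- (+ c)))
             (trans (ℤ.pos-+ (3 * L) (τ + suc u)) (cong (λ x → (+ (3 * L)) ℤ.+ x) (ℤ.pos-+ τ (suc u))))
             (ℤ.pos-+ c τ) ⟩
  ((+ (3 * L)) ℤ.- ((+ (3 * L)) ℤ.+ ((+ τ) ℤ.+ ((+ 1) ℤ.+ (+ u))))) ℤ.+ (((+ c) ℤ.+ (+ τ)) ℤ.- (+ c))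
    ≡⟨ cancel (+ (3 * L)) (+ τ) (+ u) (+ c) ⟩
  ℤ.- ((+ 1) ℤ.+ (+ u)) ∎
  where
  open ≡-Reasoning
  cancel : ∀ A T U C → (A ℤ.- (A ℤ.+ (T ℤ.+ (+ 1 ℤ.+ U)))) ℤ.+ ((C ℤ.+ T) ℤ.- C) ≡ ℤ.- (+ 1 ℤ.+ U)
  cancel = ℤ-Solver.solve-∀

pyramid-identity : ∀ k' L → L + 1 ≡ squarePyramidal (suc (suc k')) →
                   3 * L + triangle k' ≡ (suc k' + suc k') * (triangle (suc (suc k')) + suc (suc (suc k')))
pyramid-identity k' L L+1≡ = *-cancelˡ-≡ _ _ 2 (+-cancelʳ-≡ 6 _ _ (begin
  2 * (3 * L + triangle k') + 6
    ≡⟨ regroup L (triangle k') ⟩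
  6 * (L + 1) + triangle k' * 2
    ≡⟨ cong₂ (λ a b → 6 * a + b) L+1≡ (triangle-closed k') ⟩
  6 * squarePyramidal (suc k) + suc k' * k'
    ≡⟨ cong (_+ suc k' * k') (squarePyramidal-closed (suc k)) ⟩
  suc k * suc (suc k) * (2 * suc k + 1) + suc k' * k'
    ≡⟨ expand k' ⟩
  (k + k) * (suc (suc k) * suc k) + (k + k) * (2 * suc (suc k)) + 6
    ≡⟨ cong (λ a → (k + k) * a + (k + k) * (2 * suc (suc k)) + 6) (triangle-closed (suc k)) ⟨
  (k + k) * (triangle (suc k) * 2) + (k + k) * (2 * suc (suc k)) + 6
    ≡⟨ factor (k + k) (triangle (suc k)) (suc (suc k)) ⟩
  2 * ((k + k) * (triangle (suc k) + suc (suc k))) + 6 ∎))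
  where
  open ≡-Reasoning
  k = suc k'
  regroup : ∀ L h → 2 * (3 * L + h) + 6 ≡ 6 * (L + 1) + h * 2
  regroup = solve-∀
  expand : ∀ k' → suc (suc k') * suc (suc (suc k')) * (2 * suc (suc k') + 1) + suc k' * k'
         ≡ (suc k' + suc k') * (suc (suc (suc k')) * suc (suc k')) + (suc k' + suc k') * (2 * suc (suc (suc k'))) + 6
  expand = solve-∀
  factor : ∀ a b c → a * (b * 2) + a * (2 * c) + 6 ≡ 2 * (a * (b + c)) + 6
  factor = solve-∀

μ′-even : ∀ k' → μ′ (suc k' * 2) ≡ suc k' * suc k' + 2 * (suc k' * 2) + 2
μ′-even k' = cong (λ u → u + 2 * (suc k' * 2) + 2) (trans (cong (_/ 4) (square k')) (m*n/n≡m (suc k' * suc k') 4))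
  where
  square : ∀ k' → (suc k' * 2) * (suc k' * 2) ≡ (suc k' * suc k') * 4
  square = solve-∀

mult′-even : ∀ k' τ → μ′ (suc k' * 2) + τ * (suc k' * 2 / 2) ≡ suc k' * (suc k' + 4 + τ) + 2
mult′-even k' τ = trans (cong₂ _+_ (μ′-even k') (cong (τ *_) (m*n/n≡m (suc k') 2))) (regroup k' τ)
  where
  regroup : ∀ k' τ → suc k' * suc k' + 2 * (suc k' * 2) + 2 + τ * suc k' ≡ suc k' * (suc k' + 4 + τ) + 2
  regroup = solve-∀

gen′-even : ∀ k' τ → γ′ (suc k' * 2) + τ * (suc k' * 2 ∸ 1) ≡ (suc k' + k') * (suc k' + 4 + τ) + 4
gen′-even k' τ = trans (cong (_+ τ * (suc k' * 2 ∸ 1)) γ′≡) (regroup k' τ)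
  where
  γ′≡ : γ′ (suc k' * 2) ≡ (suc k' + k') * (suc k' + 4) + 4
  γ′≡ = trans (cong₂ _∸_ (trans (cong (2 *_) (μ′-even k')) (twice k')) (cong (_+ 4) (m*n/n≡m (suc k') 2)))
              (m+n∸n≡m _ (suc k' + 4))
    where
    twice : ∀ k' → 2 * (suc k' * suc k' + 2 * (suc k' * 2) + 2) ≡ (suc k' + k') * (suc k' + 4) + 4 + (suc k' + 4)
    twice = solve-∀
  regroup : ∀ k' τ → (suc k' + k') * (suc k' + 4) + 4 + τ * suc (k' * 2) ≡ (suc k' + k') * (suc k' + 4 + τ) + 4
  regroup = solve-∀

cond′-even : ∀ k' τ → (suc k' * 2) * μ′ (suc k' * 2) + τ * ((suc k' * 2) * (suc k' * 2) / 2 ∸ 1)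
           ≡ (suc k' * (suc k' + k') + k') * (suc k' + 4 + τ) + (5 * suc k' + 4)
cond′-even k' τ =
  trans (cong₂ (λ a b → (suc k' * 2) * a + τ * (b ∸ 1)) (μ′-even k')
               (trans (cong (_/ 2) (square k')) (m*n/n≡m (suc (suc k' * (suc k' + k') + k')) 2)))
        (regroup k' τ)
  where
  square : ∀ k' → (suc k' * 2) * (suc k' * 2) ≡ suc (suc k' * (suc k' + k') + k') * 2
  square = solve-∀
  regroup : ∀ k' τ → (suc k' * 2) * (suc k' * suc k' + 2 * (suc k' * 2) + 2) + τ * (suc k' * (suc k' + k') + k')
          ≡ (suc k' * (suc k' + k') + k') * (suc k' + 4 + τ) + (5 * suc k' + 4)
  regroup = solve-∀

p[p-2]/8-even : ∀ k' → (suc k' * 2) * (suc k' * 2 ∸ 2) / 8 ≡ triangle k'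
p[p-2]/8-even k' = trans (cong (_/ 8) (trans (expand k') (cong (_* 4) (sym (triangle-closed k')))))
                         (trans (cong (_/ 8) (*-assoc (triangle k') 2 4)) (m*n/n≡m (triangle k') 8))
  where
  expand : ∀ k' → (suc k' * 2) * (k' * 2) ≡ (suc k' * k') * 4
  expand = solve-∀

[p-1]²-even : ∀ k' → (suc k' * 2 ∸ 1) * (suc k' * 2 ∸ 1) ≡ 1 + 8 * triangle k'
[p-1]²-even k' = trans (expand k') (cong suc (trans (cong (_* 4) (sym (triangle-closed k'))) (regroup (triangle k'))))
  where
  expand : ∀ k' → suc (k' * 2) * suc (k' * 2) ≡ 1 + (suc k' * k') * 4
  expand = solve-∀
  regroup : ∀ x → x * 2 * 4 ≡ 8 * x
  regroup = solve-∀

corollary4p10 : (n : ℤ) → n ℤ.< + 0 →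
                (p : ℕ) → 2 ∣ p → 0 < p →
                + 1 ℤ.- + 8 ℤ.* n ℤ.≤ + ((p ∸ 1) * (p ∸ 1)) →
                (c m : ℕ) → IsConductor (Spτ n p) c → IsMultiplicity (Spτ n p) m →
                eliahou (Spτ n p) c m ≡ n
corollary4p10 (+ _)    (ℤ.+<+ ()) _ _ _ _ _ _ _ _
corollary4p10 -[1+ u ] _ _ (divides zero refl) () _ _ _ _ _
corollary4p10 -[1+ u ] _ _ (divides (suc k') refl) _ (ℤ.+≤+ 8[u+1]+1≤[p-1]²) c m isC isM =
  subst₂ (λ c m → eliahou S c m ≡ -[1+ u ]) (sym (conductor-unique isC)) (sym (multiplicity-unique isM))
    (trans (eliahou-by-parts S c₀ m₀ count-minimal-below-c length-below-c ceilDiv-c-m count-not-minimal-after-c)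
           (eliahou-arithmetic (repCount c₀) _ (k + k) m₀ c₀ τ u
              (trans (cong (λ x → 3 * repCount c₀ + x) τ+u+1≡) (pyramid-identity k' (repCount c₀) repCount-c))
              c+τ≡[k+k]m))
  where
  p = suc k' * 2
  h = p * (p ∸ 2) / 8
  τ = ℤ.∣ h ⊖ suc u ∣
  m₀ = mult′ -[1+ u ] p
  c₀ = cond′ -[1+ u ] p
  open Semigroup k' τ m₀ (gen′ -[1+ u ] p) c₀ (mult′-even k' τ) (gen′-even k' τ) (cond′-even k' τ)
  u+1≤h : suc u ≤ h
  u+1≤h = subst (suc u ≤_) (sym (p[p-2]/8-even k'))
                (*-cancelˡ-≤ 8 (+-cancelˡ-≤ 1 _ _ (subst (1 + 8 * suc u ≤_) ([p-1]²-even k') 8[u+1]+1≤[p-1]²)))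
  τ+u+1≡ : τ + suc u ≡ triangle k'
  τ+u+1≡ = trans (cong (λ x → ℤ.∣ x ∣ + suc u) (ℤ.⊖-≥ u+1≤h)) (trans (m∸n+n≡m u+1≤h) (p[p-2]/8-even k'))
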